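{- Let $u\in\mathcal W_n$ be a word of type $\mathbf m$, let $k\in\{p_j(\mathbf m): j\ge1\}$, and let $q$ be a queue. Then both $\vee^{(k)}q(u)$ and $\vee^{(k)}u$ are well-defined, and $\vee^{(k)}q(u)=q(\vee^{(k)}u)$.
   Context: Fix $n\ge1$; sites $1,\dots,n$ arranged cyclically. $\mathcal{W}_n$ is the set of words $w=w_1\cdots w_n$ with letters in $\{1,2,\dots\}$. The type of $w$ is $\mathbf m=(m_1,m_2,\dots)$, $m_i$ the number of letters equal to $i$; $p_j(\mathbf m)=m_1+\cdots+m_j$. For a word $w$ and $k\ge0$, $\vee^{(k)}w$ is the word obtained from $w$ by decreasing by $1$ all letters except the $k$ smallest ones; it is well defined exactly when $k\in\{p_j(\mathbf m):j\ge1\}$ for the type $\mathbf m$ of $w$ (so the $k$ smallest letters are uniquely determined and the others are $>1$). A queue is a subset $q\subseteq\{1,\dots,n\}$. For a queue $q$ and $u$, $v=q(u)$: choose a permutation $(i_1,\dots,i_n)$ of $(1,\dots,n)$ with $u_{i_1}\le\cdots\le u_{i_n}$; Phase I: for $i=i_n,\dots,i_{|q|+1}$ in order, take the first site $j$ weakly to the left of $i$ (cyclically) with $j\notin q$ and $v_j$ unset, set $v_j=u_i+1$; Phase II: for $i=i_1,\dots,i_{|q|}$ in order, take the first site $j$ weakly to the right of $i$ (cyclically) with $j\in q$ and $v_j$ unset, set $v_j=u_i$. -}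

module Defs where

open import Data.Nat using (ℕ; zero; suc; _+_; _∸_; _≤_; _<_; _≤?_; _<?_; NonZero)
open import Data.Nat.DivMod using (_mod_)
open import Data.Bool using (Bool; true; false; if_then_else_; not; _∧_)
open import Data.Fin using (Fin; toℕ) renaming (_≟_ to _≟ᶠ_; _≤_ to _≤ᶠ_)
open import Data.Fin.Subset using (Subset; ∣_∣)
open import Data.Fin.Permutation using (Permutation′; _⟨$⟩ʳ_)
open import Data.Maybe using (Maybe; just; nothing; is-nothing; fromMaybe)
open import Data.List using (List; allFin; take; drop; reverse; foldl)
open import Data.Vec using (Vec; lookup; tabulate; count)
open import Data.Product using (∃-syntax; _×_)
open import Relation.Nullary using (does)
open import Relation.Binary.PropositionalEquality using (_≡_)
import Data.Nat as N

-- A word of length n: letters are read at sites Fin n (site i+1 of the paper is index i).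
Word : ℕ → Set
Word n = Vec ℕ n

IsWord : ∀ {n} → Word n → Set
IsWord {n} w = (i : Fin n) → 1 ≤ lookup w i

mult : ∀ {n} → ℕ → Word n → ℕ
mult i w = count (λ x → x N.≟ i) w

p : ∀ {n} → ℕ → Word n → ℕ
p zero    w = 0
p (suc j) w = p j w + mult (suc j) w

VeeWellDefined : ∀ {n} → ℕ → Word n → Set
VeeWellDefined k w = ∃[ j ] (1 ≤ j × k ≡ p j w)

-- ∨^(k) w : decrease by 1 all letters except the k smallest ones.
-- The letter at site i belongs to "the k smallest letters" iff fewer than k
-- letters of w are strictly smaller than it (this is exactly the set of the
-- k smallest letters whenever that set is uniquely determined, i.e. whenever
-- ∨^(k) w is well defined).
vee : ∀ {n} → ℕ → Word n → Word n
vee k w = tabulate λ i →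
  let x = lookup w i in
  if does (count (λ y → y <? x) w <? k) then x else x ∸ 1

module _ {n : ℕ} {{_ : NonZero n}} where

  leftOf rightOf : Fin n → ℕ → Fin n
  leftOf  i d = ((toℕ i + n) ∸ d) mod n
  rightOf i d = (toℕ i + d) mod n

  search : (ℕ → Fin n) → (Fin n → Bool) → ℕ → ℕ → Maybe (Fin n)
  search f ok d zero    = nothing
  search f ok d (suc r) = if ok (f d) then just (f d) else search f ok (suc d) r

  State : Set
  State = Fin n → Maybe ℕ

  set : Fin n → ℕ → State → State
  set j x st j' = if does (j' ≟ᶠ j) then just x else st j'

  setAt : Maybe (Fin n) → ℕ → State → State
  setAt nothing  x st = st
  setAt (just j) x st = set j x st

  inQ : Subset n → Fin n → Bool
  inQ q j = lookup q j

  stepI : Subset n → Word n → State → Fin n → State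
  stepI q u st i =
    setAt (search (leftOf i) (λ j → not (inQ q j) ∧ is-nothing (st j)) 0 n)
          (suc (lookup u i)) st

  stepII : Subset n → Word n → State → Fin n → State
  stepII q u st i =
    setAt (search (rightOf i) (λ j → inQ q j ∧ is-nothing (st j)) 0 n)
          (lookup u i) st

  -- σ lists the sites (i_1,...,i_n) = (σ 0, ..., σ (n-1)) in weakly increasing order of u
  SortsBy : Permutation′ n → Word n → Set
  SortsBy σ u = (a b : Fin n) → a ≤ᶠ b → lookup u (σ ⟨$⟩ʳ a) ≤ lookup u (σ ⟨$⟩ʳ b)

  -- Phase I processes i_n, ..., i_{|q|+1}; Phase II processes i_1, ..., i_{|q|}.
  -- (Every site is set exactly once; the default 0 is never used.)
  queue : Subset n → Permutation′ n → Word n → Word n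
  queue q σ u = tabulate λ j → fromMaybe 0 (final j)
    where
      pos = allFin n
      phaseI  : List (Fin n)
      phaseI  = reverse (drop ∣ q ∣ pos)
      phaseII : List (Fin n)
      phaseII = take ∣ q ∣ pos
      afterI : State
      afterI = foldl (λ st a → stepI q u st (σ ⟨$⟩ʳ a)) (λ _ → nothing) phaseI
      final : State
      final = foldl (λ st a → stepII q u st (σ ⟨$⟩ʳ a)) afterI phaseII

-- A placement of value x from site i fills the free site nearest to i.  Two placements of equal
-- values commute, so q(u) does not depend on how ties among the letters of u are ordered (adjacent
-- tied entries of a sorting can be swapped one at a time).  Placements only look at which sites are
-- occupied, so relabelling values commutes with the queue.  For k = p_j(m), ∨^(k) is the monotone
-- relabelling flatten j (x ↦ x for x ≤ j, x ↦ x - 1 otherwise).  Relabelling q(u) by flatten j′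
-- relabels the phase-I values u_i + 1 and the phase-II values u_i exactly as ∨^(k) u prescribes,
-- for j′ = j when k ≤ |q| (the k smallest letters of q(u) then all come from phase II) and
-- j′ = j + 1 otherwise.  Counting letters gives k = p_{j′} for q(u), so
-- ∨^(k) q(u) = flatten j′ ∘ q(u) = q(∨^(k) u).

module Submission where

open import Defs
import Algebra.Properties.CommutativeMonoid.Sum as Sum
open import Data.Bool using (Bool; true; false; not; _∧_; if_then_else_)
import Data.Bool as Bool
open import Data.Bool.Properties using (∧-zeroʳ; ∧-identityʳ; not-involutive)
open import Data.Empty using (⊥-elim)
open import Data.Fin using (Fin; toℕ) renaming (zero to fzero; suc to fsuc; _≟_ to _≟ᶠ_)
open import Data.Fin.Permutation using (Permutation′; _⟨$⟩ʳ_; _⟨$⟩ˡ_; inverseˡ; inverseʳ)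
open import Data.Fin.Properties using (toℕ<n; toℕ-fromℕ<; toℕ-injective) renaming (suc-injective to fsuc-injective)
open import Data.Fin.Subset using (Subset; ∣_∣)
open import Data.Fin.Subset.Properties using (∣p∣≤n)
open import Data.List using (List; _∷_; foldl; foldr; applyUpTo; take; drop; reverse; allFin)
import Data.List as List
import Data.List.Properties as Listₚ
open import Data.Maybe using (Maybe; just; nothing; is-nothing; fromMaybe)
import Data.Maybe as Maybe
open import Data.Maybe.Properties using (just-injective)
open import Data.Nat using (ℕ; zero; suc; _+_; _*_; _∸_; _≤_; _<_; _≤?_; _<?_; _≟_; z≤n; s≤s; NonZero)
open import Data.Nat.DivMod
open import Data.Nat.Properties
open import Algebra.Properties.CommutativeSemigroup +-commutativeSemigroup using (interchange; x∙yz≈y∙xz)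
open import Data.Nat.Solver using (module +-*-Solver)
open import Data.Product using (∃-syntax; _×_; _,_; proj₁; proj₂)
import Data.Product as Product
open import Data.Sum using (_⊎_; inj₁; inj₂)
open import Data.Vec using (Vec; lookup; tabulate; count)
import Data.Vec as Vec
open import Data.Vec.Properties using (tabulate-cong; lookup∘tabulate)
open import Function using (_∘_; _$_; id; mk⇔)
open import Level using (_⊔_)
open import Relation.Binary.Bundles using (Setoid)
open import Relation.Binary.Definitions using (tri<; tri≈; tri>)
open import Relation.Binary.PropositionalEquality
open import Relation.Nullary using (¬_; Dec; yes; no; does)
open import Relation.Nullary.Decidable using (dec-true; dec-false; does-⇔)
open import Relation.Unary using (Pred; Decidable)

does⇒ : ∀ {P : Set} (P? : Dec P) → does P? ≡ true → P
does⇒ (yes p) _ = p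

does⇒¬ : ∀ {P : Set} (P? : Dec P) → does P? ≡ false → ¬ P
does⇒¬ (no ¬p) _ = ¬p

true≢false : true ≢ false
true≢false ()

𝟙 : Bool → ℕ
𝟙 true  = 1
𝟙 false = 0

open Sum +-0-commutativeMonoid using (sum; sum-permute)

countᵇ : ∀ {m} → (Fin m → Bool) → ℕ
countᵇ f = sum (λ i → 𝟙 (f i))

countᵇ-cong : ∀ {m} {f g : Fin m → Bool} → (∀ i → f i ≡ g i) → countᵇ f ≡ countᵇ g
countᵇ-cong f≗g = Sum.sum-cong-≗ +-0-commutativeMonoid (λ i → cong 𝟙 (f≗g i))

countᵇ-permute : ∀ {m} (f : Fin m → Bool) (π : Permutation′ m) → countᵇ f ≡ countᵇ (λ i → f (π ⟨$⟩ʳ i))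
countᵇ-permute f π = sum-permute (λ i → 𝟙 (f i)) π

countᵇ-≤ : ∀ {m} (f : Fin m → Bool) → countᵇ f ≤ m
countᵇ-≤ {zero}  f = z≤n
countᵇ-≤ {suc m} f with f fzero
... | true  = s≤s (countᵇ-≤ (f ∘ fsuc))
... | false = m≤n⇒m≤1+n (countᵇ-≤ (f ∘ fsuc))

countᵇ-false : ∀ {m} (f : Fin m → Bool) → (∀ i → f i ≡ false) → countᵇ f ≡ 0
countᵇ-false {zero}  f f≗false = refl
countᵇ-false {suc m} f f≗false rewrite f≗false fzero = countᵇ-false (f ∘ fsuc) (f≗false ∘ fsuc)

countᵇ-true : ∀ {m} (f : Fin m → Bool) → (∀ i → f i ≡ true) → countᵇ f ≡ m
countᵇ-true {zero}  f f≗true = refl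
countᵇ-true {suc m} f f≗true rewrite f≗true fzero = cong suc (countᵇ-true (f ∘ fsuc) (f≗true ∘ fsuc))

countᵇ≡size⇒true : ∀ {m} (f : Fin m → Bool) → countᵇ f ≡ m → ∀ i → f i ≡ true
countᵇ≡size⇒true {suc m} f full i with f fzero in f0
countᵇ≡size⇒true {suc m} f full fzero    | true  = f0
countᵇ≡size⇒true {suc m} f full (fsuc i) | true  = countᵇ≡size⇒true (f ∘ fsuc) (suc-injective full) i
countᵇ≡size⇒true {suc m} f full i        | false = ⊥-elim (1+n≰n (subst (_≤ m) full (countᵇ-≤ (f ∘ fsuc))))

countᵇ-positive : ∀ {m} (f : Fin m → Bool) i → f i ≡ true → 1 ≤ countᵇ f
countᵇ-positive f fzero    fi rewrite fi = s≤s z≤n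
countᵇ-positive f (fsuc i) fi = ≤-trans (countᵇ-positive (f ∘ fsuc) i fi) (m≤n+m _ (𝟙 (f fzero)))

countᵇ-<-witness : ∀ {m} (f g : Fin m → Bool) → countᵇ f < countᵇ g → ∃[ i ] (g i ≡ true × f i ≡ false)
countᵇ-<-witness {suc m} f g f<g with f fzero in f0 | g fzero in g0
... | false | true  = fzero , g0 , f0
... | true  | true  = Product.map fsuc id (countᵇ-<-witness (f ∘ fsuc) (g ∘ fsuc) (≤-pred f<g))
... | false | false = Product.map fsuc id (countᵇ-<-witness (f ∘ fsuc) (g ∘ fsuc) f<g)
... | true  | false = Product.map fsuc id (countᵇ-<-witness (f ∘ fsuc) (g ∘ fsuc) (<-trans (n<1+n _) f<g))

countᵇ-update : ∀ {m} (f g : Fin m → Bool) s → f s ≡ false → (∀ i → i ≢ s → f i ≡ g i) →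
                countᵇ g ≡ 𝟙 (g s) + countᵇ f
countᵇ-update f g fzero fs f≗g rewrite fs =
  cong (𝟙 (g fzero) +_) (countᵇ-cong (λ i → sym (f≗g (fsuc i) λ ())))
countᵇ-update f g (fsuc s) fs f≗g rewrite f≗g fzero (λ ()) =
  trans (cong (𝟙 (g fzero) +_) (countᵇ-update (f ∘ fsuc) (g ∘ fsuc) s fs (λ i i≢s → f≗g (fsuc i) (i≢s ∘ fsuc-injective))))
        (x∙yz≈y∙xz (𝟙 (g fzero)) (𝟙 (g (fsuc s))) _)

countᵇ-split : ∀ {m} (A f : Fin m → Bool) → countᵇ f ≡ countᵇ (λ i → A i ∧ f i) + countᵇ (λ i → not (A i) ∧ f i)
countᵇ-split {zero}  A f = refl
countᵇ-split {suc m} A f with A fzero | f fzero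
... | true  | true  = cong suc (countᵇ-split (A ∘ fsuc) (f ∘ fsuc))
... | true  | false = countᵇ-split (A ∘ fsuc) (f ∘ fsuc)
... | false | true  = trans (cong suc (countᵇ-split (A ∘ fsuc) (f ∘ fsuc))) (sym (+-suc _ _))
... | false | false = countᵇ-split (A ∘ fsuc) (f ∘ fsuc)

countᵇ-+ : ∀ {m} (h f g : Fin m → Bool) → (∀ i → 𝟙 (h i) ≡ 𝟙 (f i) + 𝟙 (g i)) → countᵇ h ≡ countᵇ f + countᵇ g
countᵇ-+ {zero}  h f g h≗f+g = refl
countᵇ-+ {suc m} h f g h≗f+g =
  trans (cong₂ _+_ (h≗f+g fzero) (countᵇ-+ (h ∘ fsuc) (f ∘ fsuc) (g ∘ fsuc) (h≗f+g ∘ fsuc)))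
        (interchange (𝟙 (f fzero)) _ _ _)

count≡countᵇ : ∀ {A : Set} {ℓ} {m} {P : Pred A ℓ} (P? : Decidable P) (v : Vec A m) →
               Vec.count P? v ≡ countᵇ (λ i → does (P? (lookup v i)))
count≡countᵇ P? Vec.[] = refl
count≡countᵇ P? (x Vec.∷ v) with does (P? x)
... | true  = cong suc (count≡countᵇ P? v)
... | false = count≡countᵇ P? v

countᵇ-downClosed : ∀ {m} (f : Fin m → Bool) → (∀ a b → toℕ a ≤ toℕ b → f b ≡ true → f a ≡ true) →
                    ∀ i → f i ≡ does (toℕ i <? countᵇ f)
countᵇ-downClosed {suc m} f closed i with f fzero in f0
countᵇ-downClosed {suc m} f closed fzero    | true = f0
countᵇ-downClosed {suc m} f closed (fsuc i) | true =
  countᵇ-downClosed (f ∘ fsuc) (λ a b a≤b → closed (fsuc a) (fsuc b) (s≤s a≤b)) i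
countᵇ-downClosed {suc m} f closed i        | false =
  trans (allFalse i) (sym (dec-false (toℕ i <? countᵇ (f ∘ fsuc)) (n≮0 ∘ subst (toℕ i <_) tail≡0)))
  where
    allFalse : ∀ i → f i ≡ false
    allFalse i with f i in fi
    ... | false = refl
    ... | true  = trans (sym (closed fzero i z≤n fi)) f0
    tail≡0 : countᵇ (f ∘ fsuc) ≡ 0
    tail≡0 = countᵇ-false (f ∘ fsuc) (allFalse ∘ fsuc)

Within : ∀ {ℓ} → ℕ → ℕ → (ℕ → Set ℓ) → Set ℓ
Within m len P = ∀ a → m ≤ a → a < m + len → P a

within-head : ∀ {ℓ m len} {P : ℕ → Set ℓ} → Within m (suc len) P → P m
within-head {m = m} h = h m ≤-refl (m<m+n m (s≤s z≤n))

within-tail : ∀ {ℓ m len} {P : ℕ → Set ℓ} → Within m (suc len) P → Within (suc m) len P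
within-tail {m = m} {len} h a m<a a<end = h a (<⇒≤ m<a) (subst (a <_) (sym (+-suc m len)) a<end)

countFrom : (ℕ → Bool) → ℕ → ℕ → ℕ
countFrom f m zero      = 0
countFrom f m (suc len) = 𝟙 (f m) + countFrom f (suc m) len

countFrom-true : ∀ f m len → Within m len (λ a → f a ≡ true) → countFrom f m len ≡ len
countFrom-true f m zero      h = refl
countFrom-true f m (suc len) h = cong₂ _+_ (cong 𝟙 (within-head h)) (countFrom-true f (suc m) len (within-tail h))

countFrom-false : ∀ f m len → Within m len (λ a → f a ≡ false) → countFrom f m len ≡ 0
countFrom-false f m zero      h = refl
countFrom-false f m (suc len) h = cong₂ _+_ (cong 𝟙 (within-head h)) (countFrom-false f (suc m) len (within-tail h))

countFrom-threshold : ∀ f m len K → m ≤ K → K ≤ m + len → Within m len (λ a → f a ≡ does (a <? K)) →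
                      countFrom f m len ≡ K ∸ m
countFrom-threshold f m len K m≤K K≤end h with m <? K
... | no m≮K = trans (countFrom-false f m len (λ a m≤a a<end → trans (h a m≤a a<end)
                                                   (dec-false (a <? K) (λ a<K → <⇒≱ a<K (≤-trans (≤-reflexive K≡m) m≤a)))))
                     (sym (trans (cong (_∸ m) K≡m) (n∸n≡0 m)))
  where
    K≡m : K ≡ m
    K≡m = ≤-antisym (≮⇒≥ m≮K) m≤K
countFrom-threshold f m zero      K m≤K K≤end h | yes m<K = ⊥-elim (<⇒≱ m<K (subst (K ≤_) (+-identityʳ m) K≤end))
countFrom-threshold f m (suc len) K m≤K K≤end h | yes m<K =
  trans (cong₂ _+_ (cong 𝟙 (trans (within-head h) (dec-true (m <? K) m<K)))
                   (countFrom-threshold f (suc m) len K m<K (subst (K ≤_) (+-suc m len) K≤end) (within-tail h)))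
        (sym (+-∸-assoc 1 m<K))

take-applyUpTo : ∀ {A : Set} (f : ℕ → A) k m → k ≤ m → take k (applyUpTo f m) ≡ applyUpTo f k
take-applyUpTo f zero    m       _         = refl
take-applyUpTo f (suc k) (suc m) (s≤s k≤m) = cong (f 0 ∷_) (take-applyUpTo (f ∘ suc) k m k≤m)

drop-applyUpTo : ∀ {A : Set} (f : ℕ → A) k m → drop k (applyUpTo f m) ≡ applyUpTo (λ a → f (k + a)) (m ∸ k)
drop-applyUpTo f zero    m       = refl
drop-applyUpTo f (suc k) zero    = refl
drop-applyUpTo f (suc k) (suc m) = drop-applyUpTo (f ∘ suc) k m

tabulate-applyUpTo : ∀ {A : Set} {m} (g : Fin m → A) (f : ℕ → A) → (∀ i → g i ≡ f (toℕ i)) →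
                     List.tabulate g ≡ applyUpTo f m
tabulate-applyUpTo {m = zero}  g f g≗f = refl
tabulate-applyUpTo {m = suc m} g f g≗f = cong₂ _∷_ (g≗f fzero) (tabulate-applyUpTo (g ∘ fsuc) (f ∘ suc) (g≗f ∘ fsuc))

module _ {ℓ} {S : Set ℓ} where

  foldDown : (S → ℕ → S) → S → ℕ → ℕ → S
  foldDown g s m zero      = s
  foldDown g s m (suc len) = g (foldDown g s (suc m) len) m

  foldUp : (S → ℕ → S) → S → ℕ → ℕ → S
  foldUp g s a zero      = s
  foldUp g s a (suc len) = foldUp g (g s a) (suc a) len

  foldUp-last : ∀ (g : S → ℕ → S) s a len → foldUp g s a (suc len) ≡ g (foldUp g s a len) (a + len)
  foldUp-last g s a zero      = cong (g s) (sym (+-identityʳ a))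
  foldUp-last g s a (suc len) = trans (foldUp-last g (g s a) (suc a) len) (cong (g _) (sym (+-suc a len)))

  foldr-applyUpTo : ∀ {A : Set} (h : S → A → S) (x : ℕ → A) s m len (f : ℕ → A) → (∀ a → f a ≡ x (m + a)) →
                    foldr (λ a s → h s a) s (applyUpTo f len) ≡ foldDown (λ s a → h s (x a)) s m len
  foldr-applyUpTo h x s m zero      f f≗x = refl
  foldr-applyUpTo h x s m (suc len) f f≗x =
    cong₂ h (foldr-applyUpTo h x s (suc m) len (f ∘ suc) (λ a → trans (f≗x (suc a)) (cong x (+-suc m a))))
            (trans (f≗x 0) (cong x (+-identityʳ m)))

  foldl-applyUpTo : ∀ {A : Set} (h : S → A → S) (x : ℕ → A) s m len (f : ℕ → A) → (∀ a → f a ≡ x (m + a)) →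
                    foldl h s (applyUpTo f len) ≡ foldUp (λ s a → h s (x a)) s m len
  foldl-applyUpTo h x s m zero      f f≗x = refl
  foldl-applyUpTo h x s m (suc len) f f≗x rewrite f≗x 0 | +-identityʳ m =
    foldl-applyUpTo h x (h s (x m)) (suc m) len (f ∘ suc) (λ a → trans (f≗x (suc a)) (cong x (+-suc m a)))

module _ {a b r} {S : Set a} {T : Set b} (R : S → T → Set r) where

  Simulates : (S → ℕ → S) → (T → ℕ → T) → ℕ → Set (a ⊔ b ⊔ r)
  Simulates g g′ i = ∀ {s t} → R s t → R (g s i) (g′ t i)

  foldDown-sim : ∀ {g g′ s t} m len → Within m len (Simulates g g′) → R s t → R (foldDown g s m len) (foldDown g′ t m len)
  foldDown-sim m zero      H sRt = sRt
  foldDown-sim m (suc len) H sRt = within-head H (foldDown-sim (suc m) len (within-tail H) sRt)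

  foldUp-sim : ∀ {g g′ s t} m len → Within m len (Simulates g g′) → R s t → R (foldUp g s m len) (foldUp g′ t m len)
  foldUp-sim m zero      H sRt = sRt
  foldUp-sim m (suc len) H sRt = foldUp-sim (suc m) len (within-tail H) (within-head H sRt)

module AdjacentSwaps {c ℓ} (S : Setoid c ℓ) where
  open Setoid S renaming (refl to ≈-refl; sym to ≈-sym; trans to ≈-trans)

  record AdjacentSwap (g g′ : Carrier → ℕ → Carrier) (p : ℕ) : Set (c ⊔ ℓ) where
    field
      congˡ     : ∀ a → Simulates _≈_ g g a
      congʳ     : ∀ a → Simulates _≈_ g′ g′ a
      elsewhere : ∀ s a → a ≢ p → a ≢ suc p → g′ s a ≈ g s a
      at-p      : ∀ s → g′ s p ≈ g s (suc p)
      at-suc-p  : ∀ s → g′ s (suc p) ≈ g s p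
      commute   : ∀ s → g (g s p) (suc p) ≈ g (g s (suc p)) p

  module _ {g g′ : Carrier → ℕ → Carrier} {p : ℕ} (H : AdjacentSwap g g′ p) where
    open AdjacentSwap H

    agree-above : ∀ a → suc p < a → Simulates _≈_ g′ g a
    agree-above a p+1<a s≈s′ =
      ≈-trans (congʳ a s≈s′) (elsewhere _ a (λ a≡p → <⇒≱ p+1<a (≤-trans (≤-reflexive a≡p) (n≤1+n p)))
                                           (λ a≡p+1 → <⇒≱ p+1<a (≤-reflexive a≡p+1)))

    foldDown-swap : ∀ s m len → m ≤ p → suc p < m + len → foldDown g′ s m len ≈ foldDown g s m len
    foldDown-swap s m zero      m≤p p+1<m = ⊥-elim (<⇒≱ p+1<m (≤-trans (≤-reflexive (+-identityʳ m)) (m≤n⇒m≤1+n m≤p)))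
    foldDown-swap s m (suc len) m≤p p+1<end with m ≟ p
    ... | no m≢p =
      ≈-trans (congʳ m (foldDown-swap s (suc m) len m<p (subst (suc p <_) (+-suc m len) p+1<end)))
              (elsewhere _ m m≢p (λ m≡p+1 → <⇒≱ m<p (≤-trans (n≤1+n p) (≤-reflexive (sym m≡p+1)))))
      where m<p = ≤∧≢⇒< m≤p m≢p
    foldDown-swap s m (suc zero)      m≤p p+1<end | yes refl = ⊥-elim (<⇒≱ p+1<end (≤-reflexive (+-comm m 1)))
    foldDown-swap s m (suc (suc len)) m≤p p+1<end | yes refl =
      ≈-trans (at-p _) (≈-trans (congˡ (suc m) (≈-trans (at-suc-p _) (congˡ m rest≈))) (commute _))
      where
        rest≈ : foldDown g′ s (suc (suc m)) len ≈ foldDown g s (suc (suc m)) len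
        rest≈ = foldDown-sim _≈_ (suc (suc m)) len (λ a p+1<a _ → agree-above a p+1<a) ≈-refl

    foldUp-swap : ∀ s a len → a ≤ p → suc p < a + len → foldUp g′ s a len ≈ foldUp g s a len
    foldUp-swap s a zero      a≤p p+1<a = ⊥-elim (<⇒≱ p+1<a (≤-trans (≤-reflexive (+-identityʳ a)) (m≤n⇒m≤1+n a≤p)))
    foldUp-swap s a (suc len) a≤p p+1<end with a ≟ p
    ... | no a≢p =
      ≈-trans (foldUp-swap (g′ s a) (suc a) len a<p (subst (suc p <_) (+-suc a len) p+1<end))
              (foldUp-sim _≈_ (suc a) len (λ x _ _ → congˡ x)
                 (elsewhere s a a≢p (λ a≡p+1 → <⇒≱ a<p (≤-trans (n≤1+n p) (≤-reflexive (sym a≡p+1))))))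
      where a<p = ≤∧≢⇒< a≤p a≢p
    foldUp-swap s a (suc zero)      a≤p p+1<end | yes refl = ⊥-elim (<⇒≱ p+1<end (≤-reflexive (+-comm a 1)))
    foldUp-swap s a (suc (suc len)) a≤p p+1<end | yes refl =
      foldUp-sim _≈_ (suc (suc a)) len (λ x p+1<x _ → agree-above x p+1<x)
        (≈-trans (at-suc-p _) (≈-trans (congˡ a (at-p s)) (≈-sym (commute s))))

swap : ℕ → ℕ → ℕ
swap p a with a ≟ p
... | yes _ = suc p
... | no  _ with a ≟ suc p
...   | yes _ = p
...   | no  _ = a

swap-at : ∀ p → swap p p ≡ suc p
swap-at p with p ≟ p
... | yes _   = refl
... | no  p≢p = ⊥-elim (p≢p refl)

swap-at-suc : ∀ p → swap p (suc p) ≡ p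
swap-at-suc p with suc p ≟ p
... | yes p+1≡p = ⊥-elim (1+n≢n p+1≡p)
... | no  _ with suc p ≟ suc p
...   | yes _ = refl
...   | no  ≢ = ⊥-elim (≢ refl)

swap-other : ∀ p a → a ≢ p → a ≢ suc p → swap p a ≡ a
swap-other p a a≢p a≢p+1 with a ≟ p
... | yes a≡p = ⊥-elim (a≢p a≡p)
... | no  _ with a ≟ suc p
...   | yes a≡p+1 = ⊥-elim (a≢p+1 a≡p+1)
...   | no  _     = refl

swap-involutive : ∀ p a → swap p (swap p a) ≡ a
swap-involutive p a with a ≟ p
... | yes refl = swap-at-suc a
... | no  a≢p with a ≟ suc p
...   | yes refl  = swap-at p
...   | no  a≢p+1 = swap-other p a a≢p a≢p+1

swap-< : ∀ {n} p a → suc p < n → a < n → swap p a < n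
swap-< p a p+1<n a<n with a ≟ p
... | yes _ = p+1<n
... | no  _ with a ≟ suc p
...   | yes _ = <-trans (n<1+n p) p+1<n
...   | no  _ = a<n

satisfies : (ℕ → Bool) → Maybe ℕ → Bool
satisfies P nothing  = false
satisfies P (just x) = P x

always : ℕ → Bool
always _ = true

is-nothing-map : ∀ {A B : Set} (h : A → B) m → is-nothing (Maybe.map h m) ≡ is-nothing m
is-nothing-map h nothing  = refl
is-nothing-map h (just _) = refl

module _ {n : ℕ} {{_ : NonZero n}} where

  toℕ-mod : ∀ m → toℕ (m mod n) ≡ m % n
  toℕ-mod m = toℕ-fromℕ< (m%n<n m n)

  [m+k%n]%n≡[m+k]%n : ∀ m k → (m + k % n) % n ≡ (m + k) % n
  [m+k%n]%n≡[m+k]%n m k = begin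
    (m + k % n) % n          ≡⟨ %-distribˡ-+ m (k % n) n ⟩
    (m % n + k % n % n) % n  ≡⟨ cong (λ t → (m % n + t) % n) (m%n%n≡m%n k n) ⟩
    (m % n + k % n) % n      ≡⟨ %-distribˡ-+ m k n ⟨
    (m + k) % n              ∎
    where open ≡-Reasoning

  [m%n+k]%n≡[m+k]%n : ∀ m k → (m % n + k) % n ≡ (m + k) % n
  [m%n+k]%n≡[m+k]%n m k = begin
    (m % n + k) % n   ≡⟨ cong (_% n) (+-comm (m % n) k) ⟩
    (k + m % n) % n   ≡⟨ [m+k%n]%n≡[m+k]%n k m ⟩
    (k + m) % n       ≡⟨ cong (_% n) (+-comm k m) ⟩
    (m + k) % n       ∎
    where open ≡-Reasoning

  [m+k∸k%n]%n≡m : ∀ m k → m < n → ((m + k) ∸ k % n) % n ≡ m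
  [m+k∸k%n]%n≡m m k m<n = begin
    ((m + k) ∸ k % n) % n                          ≡⟨ cong (λ t → ((m + t) ∸ k % n) % n) (m≡m%n+[m/n]*n k n) ⟩
    ((m + (k % n + (k / n) * n)) ∸ k % n) % n      ≡⟨ cong (λ t → (t ∸ k % n) % n) (x∙yz≈y∙xz m (k % n) _) ⟩
    ((k % n + (m + (k / n) * n)) ∸ k % n) % n      ≡⟨ cong (_% n) (m+n∸m≡n (k % n) _) ⟩
    (m + (k / n) * n) % n                          ≡⟨ [m+kn]%n≡m%n m (k / n) n ⟩
    m % n                                          ≡⟨ m<n⇒m%n≡m m<n ⟩
    m                                              ∎
    where open ≡-Reasoning

  gap : Fin n → Fin n → ℕ
  gap i s = ((toℕ i + n) ∸ toℕ s) % n

  gap<n : ∀ i s → gap i s < n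
  gap<n i s = m%n<n _ n

  private
    +n-split : ∀ a s → s < n → a + n ≡ s + ((a + n) ∸ s)
    +n-split a s s<n = sym (m+[n∸m]≡n (≤-trans (<⇒≤ s<n) (m≤n+m n a)))

  leftOf-gap : ∀ i s → leftOf i (gap i s) ≡ s
  leftOf-gap i s = toℕ-injective (begin
    toℕ (leftOf i (gap i s))                                  ≡⟨ toℕ-mod _ ⟩
    ((toℕ i + n) ∸ gap i s) % n                               ≡⟨ cong (λ t → (t ∸ gap i s) % n)
                                                                     (+n-split (toℕ i) (toℕ s) (toℕ<n s)) ⟩
    ((toℕ s + ((toℕ i + n) ∸ toℕ s)) ∸ gap i s) % n           ≡⟨ [m+k∸k%n]%n≡m (toℕ s) _ (toℕ<n s) ⟩
    toℕ s                                                     ∎)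
    where open ≡-Reasoning

  gap-leftOf : ∀ i e → e < n → gap i (leftOf i e) ≡ e
  gap-leftOf i e e<n = begin
    ((toℕ i + n) ∸ toℕ (leftOf i e)) % n                      ≡⟨ cong (λ t → ((toℕ i + n) ∸ t) % n) (toℕ-mod _) ⟩
    ((toℕ i + n) ∸ ((toℕ i + n) ∸ e) % n) % n                 ≡⟨ cong (λ t → (t ∸ ((toℕ i + n) ∸ e) % n) % n)
                                                                     (+n-split (toℕ i) e e<n) ⟩
    ((e + ((toℕ i + n) ∸ e)) ∸ ((toℕ i + n) ∸ e) % n) % n     ≡⟨ [m+k∸k%n]%n≡m e _ e<n ⟩
    e                                                         ∎
    where open ≡-Reasoning

  rightOf-gap : ∀ i s → rightOf i (gap s i) ≡ s
  rightOf-gap i s = toℕ-injective (begin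
    toℕ (rightOf i (gap s i))                 ≡⟨ toℕ-mod _ ⟩
    (toℕ i + gap s i) % n                     ≡⟨ [m+k%n]%n≡[m+k]%n (toℕ i) _ ⟩
    (toℕ i + ((toℕ s + n) ∸ toℕ i)) % n       ≡⟨ cong (_% n) (m+[n∸m]≡n (≤-trans (<⇒≤ (toℕ<n i)) (m≤n+m n (toℕ s)))) ⟩
    (toℕ s + n) % n                           ≡⟨ [m+n]%n≡m%n (toℕ s) n ⟩
    toℕ s % n                                 ≡⟨ m<n⇒m%n≡m (toℕ<n s) ⟩
    toℕ s                                     ∎)
    where open ≡-Reasoning

  gap-rightOf : ∀ i e → e < n → gap (rightOf i e) i ≡ e
  gap-rightOf i e e<n = begin
    ((toℕ (rightOf i e) + n) ∸ toℕ i) % n     ≡⟨ cong (λ t → ((t + n) ∸ toℕ i) % n) (toℕ-mod _) ⟩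
    (((toℕ i + e) % n + n) ∸ toℕ i) % n       ≡⟨ cong (_% n) (+-∸-assoc ((toℕ i + e) % n) i≤n) ⟩
    ((toℕ i + e) % n + (n ∸ toℕ i)) % n       ≡⟨ [m%n+k]%n≡[m+k]%n (toℕ i + e) _ ⟩
    ((toℕ i + e) + (n ∸ toℕ i)) % n           ≡⟨ cong (_% n) (solve 3 (λ i e d → (i :+ e) :+ d := e :+ (i :+ d))
                                                                  refl (toℕ i) e (n ∸ toℕ i)) ⟩
    (e + (toℕ i + (n ∸ toℕ i))) % n           ≡⟨ cong (λ t → (e + t) % n) (m+[n∸m]≡n i≤n) ⟩
    (e + n) % n                               ≡⟨ [m+n]%n≡m%n e n ⟩
    e % n                                     ≡⟨ m<n⇒m%n≡m e<n ⟩
    e                                         ∎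
    where
      open ≡-Reasoning
      open +-*-Solver
      i≤n = <⇒≤ (toℕ<n i)

  gap-triangle : ∀ a b c → gap a c ≡ (gap a b + gap b c) % n
  gap-triangle a b c = sym (begin
    (gap a b + gap b c) % n                                   ≡⟨ %-distribˡ-+ _ _ n ⟨
    (((toℕ a + n) ∸ toℕ b) + ((toℕ b + n) ∸ toℕ c)) % n       ≡⟨ cong (_% n) telescope ⟩
    (((toℕ a + n) ∸ toℕ c) + n) % n                           ≡⟨ [m+n]%n≡m%n _ n ⟩
    gap a c                                                   ∎)
    where
      open ≡-Reasoning
      open +-*-Solver
      b≤n = <⇒≤ (toℕ<n b)
      c≤n = <⇒≤ (toℕ<n c)
      telescope : ((toℕ a + n) ∸ toℕ b) + ((toℕ b + n) ∸ toℕ c) ≡ ((toℕ a + n) ∸ toℕ c) + n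
      telescope = begin
        ((toℕ a + n) ∸ toℕ b) + ((toℕ b + n) ∸ toℕ c)         ≡⟨ cong₂ _+_ (+-∸-assoc (toℕ a) b≤n) (+-∸-assoc (toℕ b) c≤n) ⟩
        (toℕ a + (n ∸ toℕ b)) + (toℕ b + (n ∸ toℕ c))         ≡⟨ solve 4 (λ a x b y → (a :+ x) :+ (b :+ y) := (a :+ y) :+ (x :+ b))
                                                                          refl (toℕ a) _ (toℕ b) _ ⟩
        (toℕ a + (n ∸ toℕ c)) + ((n ∸ toℕ b) + toℕ b)         ≡⟨ cong₂ _+_ (sym (+-∸-assoc (toℕ a) c≤n)) (m∸n+n≡m b≤n) ⟩
        ((toℕ a + n) ∸ toℕ c) + n                             ∎

  set-≡ : ∀ (s : Fin n) x st → set s x st s ≡ just x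
  set-≡ s x st with s ≟ᶠ s
  ... | yes _   = refl
  ... | no  s≢s = ⊥-elim (s≢s refl)

  set-≢ : ∀ {s j : Fin n} x st → j ≢ s → set s x st j ≡ st j
  set-≢ {s} {j} x st j≢s with j ≟ᶠ s
  ... | yes j≡s = ⊥-elim (j≢s j≡s)
  ... | no  _   = refl

  set-comm : ∀ (s s′ : Fin n) x st → set s′ x (set s x st) ≗ set s x (set s′ x st)
  set-comm s s′ x st j with j ≟ᶠ s′ | j ≟ᶠ s
  ... | yes _ | yes _ = refl
  ... | yes _ | no  _ = refl
  ... | no  _ | yes _ = refl
  ... | no  _ | no  _ = refl

  set-cong : ∀ (s : Fin n) x {st st′ : State} → st ≗ st′ → set s x st ≗ set s x st′
  set-cong s x st≗st′ j with j ≟ᶠ s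
  ... | yes _ = refl
  ... | no  _ = st≗st′ j

  countIn : (Fin n → Bool) → (ℕ → Bool) → State → ℕ
  countIn A P st = countᵇ (λ j → A j ∧ satisfies P (st j))

  countIn-fill : ∀ A P st s x → A s ≡ true → st s ≡ nothing → countIn A P (set s x st) ≡ 𝟙 (P x) + countIn A P st
  countIn-fill A P st s x As unset =
    trans (countᵇ-update _ _ s (trans (cong (λ m → A s ∧ satisfies P m) unset) (∧-zeroʳ (A s)))
                             (λ j j≢s → cong (λ m → A j ∧ satisfies P m) (sym (set-≢ x st j≢s))))
          (cong₂ (λ b m → 𝟙 (b ∧ satisfies P m) + countIn A P st) As (set-≡ s x st))

  hole-exists : ∀ A st → countIn A always st < countᵇ A → ∃[ j ] (A j ≡ true × st j ≡ nothing)
  hole-exists A st lt with countᵇ-<-witness _ A lt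
  ... | j , Aj , unfilled = j , Aj , unset (st j) (subst (λ b → (b ∧ satisfies always (st j)) ≡ false) Aj unfilled)
    where
      unset : ∀ m → satisfies always m ≡ false → m ≡ nothing
      unset nothing _ = refl

  record CyclicScan : Set where
    field
      walk          : Fin n → ℕ → Fin n
      dist          : Fin n → Fin n → ℕ
      dist<n        : ∀ i s → dist i s < n
      walk-dist     : ∀ i s → walk i (dist i s) ≡ s
      dist-walk     : ∀ i e → e < n → dist i (walk i e) ≡ e
      dist-triangle : ∀ i s x → dist i x ≡ (dist i s + dist s x) % n

  leftward : CyclicScan
  leftward = record
    { walk = leftOf ; dist = gap ; dist<n = gap<n ; walk-dist = leftOf-gap ; dist-walk = gap-leftOf
    ; dist-triangle = gap-triangle }

  rightward : CyclicScan
  rightward = record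
    { walk = rightOf ; dist = λ i s → gap s i ; dist<n = λ i s → gap<n s i ; walk-dist = rightOf-gap
    ; dist-walk = gap-rightOf
    ; dist-triangle = λ i s x → trans (gap-triangle x s i) (cong (_% n) (+-comm (gap x s) (gap s i))) }

  data SearchResult (f : ℕ → Fin n) (ok : Fin n → Bool) (d r : ℕ) : Maybe (Fin n) → Set where
    none  : Within d r (λ e → ok (f e) ≡ false) → SearchResult f ok d r nothing
    first : ∀ e → d ≤ e → e < d + r → ok (f e) ≡ true → (∀ e′ → d ≤ e′ → e′ < e → ok (f e′) ≡ false) →
            SearchResult f ok d r (just (f e))

  private
    by-≤-cases : ∀ {d e} {P : Set} → d ≤ e → (d ≡ e → P) → (d < e → P) → P
    by-≤-cases {d} {e} d≤e eq lt with d ≟ e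
    ... | yes d≡e = eq d≡e
    ... | no  d≢e = lt (≤∧≢⇒< d≤e d≢e)

  search-correct : ∀ f ok d r → SearchResult f ok d r (search f ok d r)
  search-correct f ok d zero    = none λ e d≤e e<d+0 → ⊥-elim (<⇒≱ e<d+0 (subst (_≤ e) (sym (+-identityʳ d)) d≤e))
  search-correct f ok d (suc r) with ok (f d) in okd
  ... | true  = first d ≤-refl (m<m+n d (s≤s z≤n)) okd (λ e′ d≤e′ e′<d → ⊥-elim (<⇒≱ e′<d d≤e′))
  ... | false with search f ok (suc d) r | search-correct f ok (suc d) r
  ...   | _ | none later =
    none λ e d≤e e<end → by-≤-cases d≤e (λ { refl → okd }) (λ d<e → later e d<e (subst (e <_) (+-suc d r) e<end))
  ...   | _ | first e d<e e<end oke before =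
    first e (<⇒≤ d<e) (subst (e <_) (sym (+-suc d r)) e<end) oke
          (λ e′ d≤e′ e′<e → by-≤-cases d≤e′ (λ { refl → okd }) (λ d<e′ → before e′ d<e′ e′<e))

  search-cong : ∀ (f : ℕ → Fin n) {ok ok′ : Fin n → Bool} d r → (∀ j → ok j ≡ ok′ j) → search f ok d r ≡ search f ok′ d r
  search-cong f d zero    ok≗ok′ = refl
  search-cong f d (suc r) ok≗ok′ =
    cong₂ (λ b m → if b then just (f d) else m) (ok≗ok′ (f d)) (search-cong f (suc d) r ok≗ok′)

  module Scan (C : CyclicScan) where
    open CyclicScan C

    NearestSite : Fin n → (Fin n → Bool) → Fin n → Set
    NearestSite i ok s = ok s ≡ true × (∀ x → ok x ≡ true → dist i s ≤ dist i x)

    data Nearest (i : Fin n) (ok : Fin n → Bool) : Maybe (Fin n) → Set where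
      none  : (∀ x → ok x ≡ false) → Nearest i ok nothing
      found : ∀ s → NearestSite i ok s → Nearest i ok (just s)

    search-nearest : ∀ i ok → Nearest i ok (search (walk i) ok 0 n)
    search-nearest i ok with search (walk i) ok 0 n | search-correct (walk i) ok 0 n
    ... | _ | none never = none λ x → subst (λ t → ok t ≡ false) (walk-dist i x) (never (dist i x) z≤n (dist<n i x))
    ... | _ | first e _ e<n oke before = found (walk i e) (oke , nearest)
      where
        nearest : ∀ x → ok x ≡ true → dist i (walk i e) ≤ dist i x
        nearest x okx with dist i x <? dist i (walk i e)
        ... | no  x≮e = ≮⇒≥ x≮e
        ... | yes x<e = ⊥-elim (true≢false (begin
          true             ≡⟨ okx ⟨
          ok x             ≡⟨ cong ok (walk-dist i x) ⟨
          ok (walk i (dist i x)) ≡⟨ before (dist i x) z≤n (subst (dist i x <_) (dist-walk i e e<n) x<e) ⟩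
          false            ∎))
          where open ≡-Reasoning

    nearest-unique : ∀ {i ok m m′} → Nearest i ok m → Nearest i ok m′ → m ≡ m′
    nearest-unique (none _) (none _) = refl
    nearest-unique (none never) (found s (oks , _)) = ⊥-elim (true≢false (trans (sym oks) (never s)))
    nearest-unique (found s (oks , _)) (none never) = ⊥-elim (true≢false (trans (sym oks) (never s)))
    nearest-unique {i} (found s (oks , s≤)) (found s′ (oks′ , s′≤)) =
      cong just (trans (sym (walk-dist i s)) (trans (cong (walk i) (≤-antisym (s≤ s′ oks′) (s′≤ s oks))) (walk-dist i s′)))

    dist-via-nearest : ∀ a s (ok : Fin n → Bool) → (∀ x → ok x ≡ true → dist a s ≤ dist a x) →
                       ∀ x → ok x ≡ true → dist a x ≡ dist a s + dist s x
    dist-via-nearest a s ok s≤ x okx with dist a s + dist s x <? n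
    ... | yes S<n = trans (dist-triangle a s x) (m<n⇒m%n≡m S<n)
    ... | no  S≮n = ⊥-elim (<⇒≱ x<s (s≤ x okx))
      where
        S = dist a s + dist s x
        n≤S = ≮⇒≥ S≮n
        S∸n<s : S ∸ n < dist a s
        S∸n<s = subst (S ∸ n <_) (m+n∸n≡m (dist a s) n) (∸-monoˡ-< (+-monoʳ-< (dist a s) (dist<n s x)) n≤S)
        x≡S∸n : dist a x ≡ S ∸ n
        x≡S∸n = trans (dist-triangle a s x)
                      (trans (sym (m≤n⇒[n∸m]%m≡n%m n≤S)) (m<n⇒m%n≡m (<-≤-trans S∸n<s (<⇒≤ (dist<n a s)))))
        x<s : dist a x < dist a s
        x<s = subst (_< dist a s) (sym x≡S∸n) S∸n<s

    nearest-transfer : ∀ a b s ok {m} → (∀ x → ok x ≡ true → dist a s ≤ dist a x) →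
                       (∀ x → ok x ≡ true → dist b s ≤ dist b x) → Nearest a ok m → Nearest b ok m
    nearest-transfer a b s ok sa sb (none never) = none never
    nearest-transfer a b s ok sa sb (found t (okt , t≤)) = found t (okt , λ x okx →
      subst₂ _≤_ (sym (dist-via-nearest b s ok sb t okt)) (sym (dist-via-nearest b s ok sb x okx))
        (+-monoʳ-≤ (dist b s) (+-cancelˡ-≤ (dist a s) _ _
          (subst₂ _≤_ (dist-via-nearest a s ok sa t okt) (dist-via-nearest a s ok sa x okx) (t≤ x okx)))))

    module Placement (A : Fin n → Bool) where

      free : State → Fin n → Bool
      free st j = A j ∧ is-nothing (st j)

      place : State → Fin n → ℕ → State
      place st i x = setAt (search (walk i) (free st) 0 n) x st

      free⇒ : ∀ st j → free st j ≡ true → A j ≡ true × st j ≡ nothing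
      free⇒ st j fr with A j | st j
      ... | true  | nothing = refl , refl

      hole⇒free : ∀ {st st′} s → st′ ≗ st → A s ≡ true × st s ≡ nothing → free st′ s ≡ true
      hole⇒free s st′≗st (As , unset) = cong₂ _∧_ As (cong is-nothing (trans (st′≗st s) unset))

      free-set⇒free : ∀ s x st j → free (set s x st) j ≡ true → free st j ≡ true
      free-set⇒free s x st j fr with j ≟ᶠ s
      ... | no  _    = fr
      ... | yes refl rewrite ∧-zeroʳ (A j) = ⊥-elim (true≢false (sym fr))

      free-set-≢ : ∀ s x st j → j ≢ s → free (set s x st) j ≡ free st j
      free-set-≢ s x st j j≢s = cong (λ m → A j ∧ is-nothing m) (set-≢ x st j≢s)

      place-cong : ∀ {st st′} i x → st ≗ st′ → place st i x ≗ place st′ i x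
      place-cong {st} {st′} i x st≗st′ j
        rewrite search-cong (walk i) 0 n (λ j → cong (λ m → A j ∧ is-nothing m) (st≗st′ j))
        with search (walk i) (free st′) 0 n
      ... | nothing = st≗st′ j
      ... | just s  = set-cong s x st≗st′ j

      place-view : ∀ st i x → (place st i x ≡ st × (∀ y → free st y ≡ false))
                            ⊎ ∃[ s ] (place st i x ≡ set s x st × NearestSite i (free st) s)
      place-view st i x with search (walk i) (free st) 0 n | search-nearest i (free st)
      ... | _ | none never        = inj₁ (refl , never)
      ... | _ | found s nearest = inj₂ (s , refl , nearest)

      place-nearest : ∀ st i x s → NearestSite i (free st) s → place st i x ≡ set s x st
      place-nearest st i x s (frs , s≤) with place-view st i x
      ... | inj₁ (_ , never)          = ⊥-elim (true≢false (trans (sym frs) (never s)))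
      ... | inj₂ (t , e , frt , t≤) = trans e (cong (λ u → set u x st) (just-injective
                                        (nearest-unique (found t (frt , t≤)) (found s (frs , s≤)))))

      nearest-after-set : ∀ st i s s′ x → NearestSite i (free st) s′ → s′ ≢ s → NearestSite i (free (set s x st)) s′
      nearest-after-set st i s s′ x (frs′ , s′≤) s′≢s =
        trans (free-set-≢ s x st s′ s′≢s) frs′ , λ y fry → s′≤ y (free-set⇒free s x st y fry)

      place-comm : ∀ st i i′ x → place (place st i x) i′ x ≗ place (place st i′ x) i x
      place-comm st i i′ x j with place-view st i x | place-view st i′ x
      ... | inj₁ (e , _) | inj₁ (e′ , _) rewrite e | e′ | e = refl
      ... | inj₁ (_ , never) | inj₂ (s′ , _ , frs′ , _) = ⊥-elim (true≢false (trans (sym frs′) (never s′)))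
      ... | inj₂ (s , _ , frs , _) | inj₁ (_ , never) = ⊥-elim (true≢false (trans (sym frs) (never s)))
      ... | inj₂ (s , e , cl) | inj₂ (s′ , e′ , cl′) rewrite e | e′ with s ≟ᶠ s′
      -- Same site s: afterwards, distances from i and from i′ to the free sites both factor through s.
      ...   | yes refl = cong (λ m → setAt m x st′ j) (nearest-unique
                           (nearest-transfer i′ i s (free st′) (λ y → proj₂ cl′ y ∘ free-set⇒free s x st y)
                                                               (λ y → proj₂ cl y ∘ free-set⇒free s x st y)
                              (search-nearest i′ (free st′)))
                           (search-nearest i (free st′)))
        where st′ = set s x st
      ...   | no s≢s′ = begin
        place (set s x st) i′ x j   ≡⟨ cong (_$ j) (place-nearest _ i′ x s′ (nearest-after-set st i′ s s′ x cl′ (s≢s′ ∘ sym))) ⟩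
        set s′ x (set s x st) j     ≡⟨ set-comm s s′ x st j ⟩
        set s x (set s′ x st) j     ≡⟨ cong (_$ j) (place-nearest _ i x s (nearest-after-set st i s′ s x cl s≢s′)) ⟨
        place (set s′ x st) i x j   ∎
        where open ≡-Reasoning

      place-into-free : ∀ st i x s₀ → free st s₀ ≡ true → ∃[ s ] (free st s ≡ true × place st i x ≡ set s x st)
      place-into-free st i x s₀ frs₀ with place-view st i x
      ... | inj₁ (_ , never)      = ⊥-elim (true≢false (trans (sym frs₀) (never s₀)))
      ... | inj₂ (s , e , frs , _) = s , frs , e

      place-forced : ∀ st i x s₀ → free st s₀ ≡ true → satisfies always (place st i x s₀) ≡ true → place st i x ≡ set s₀ x st
      place-forced st i x s₀ frs₀ filled with place-into-free st i x s₀ frs₀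
      ... | s , _ , e with s₀ ≟ᶠ s
      ...   | yes refl = e
      ...   | no s₀≢s = ⊥-elim (true≢false (begin
        true                                ≡⟨ filled ⟨
        satisfies always (place st i x s₀)  ≡⟨ cong (λ st′ → satisfies always (st′ s₀)) e ⟩
        satisfies always (set s x st s₀)    ≡⟨ cong (satisfies always) (set-≢ x st s₀≢s) ⟩
        satisfies always (st s₀)            ≡⟨ cong (satisfies always) (proj₂ (free⇒ st s₀ frs₀)) ⟩
        false                               ∎))
        where open ≡-Reasoning

      place-map : ∀ (h : ℕ → ℕ) {st st′} i {x x′} → h x ≡ x′ → st′ ≗ Maybe.map h ∘ st →
                  place st′ i x′ ≗ Maybe.map h ∘ place st i x
      place-map h {st} {st′} i refl st′≗hst j
        rewrite search-cong (walk i) 0 n (λ j → cong (A j ∧_) (trans (cong is-nothing (st′≗hst j)) (is-nothing-map h (st j))))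
        with search (walk i) (free st) 0 n
      ... | nothing = st′≗hst j
      ... | just s with j ≟ᶠ s
      ...   | yes _ = refl
      ...   | no  _ = st′≗hst j

      place-fills-hole : ∀ st i x → countIn A always st < countᵇ A →
        (∀ j → A j ≡ false → place st i x j ≡ st j) × (∀ P → countIn A P (place st i x) ≡ 𝟙 (P x) + countIn A P st)
      place-fills-hole st i x lt with hole-exists A st lt
      ... | s₀ , hole with place-into-free st i x s₀ (hole⇒free {st} s₀ (λ _ → refl) hole)
      ...   | s , frs , e = kept , counted
        where
          kept : ∀ j → A j ≡ false → place st i x j ≡ st j
          kept j ¬Aj = trans (cong (_$ j) e) (set-≢ x st λ { refl → true≢false (trans (sym (proj₁ (free⇒ st s frs))) ¬Aj) })
          counted : ∀ P → countIn A P (place st i x) ≡ 𝟙 (P x) + countIn A P st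
          counted P = trans (cong (countIn A P) e) (countIn-fill A P st s x (proj₁ (free⇒ st s frs)) (proj₂ (free⇒ st s frs)))

      place-forced-agree : ∀ {st st′} i i′ {x x′} s₀ → st ≗ st′ → x ≡ x′ → free st s₀ ≡ true →
                           satisfies always (place st i x s₀) ≡ true → satisfies always (place st′ i′ x′ s₀) ≡ true →
                           place st i x ≗ place st′ i′ x′
      place-forced-agree {st} {st′} i i′ {x} s₀ st≗st′ refl frs₀ filled filled′ j = begin
        place st i x j     ≡⟨ cong (_$ j) (place-forced st i x s₀ frs₀ filled) ⟩
        set s₀ x st j      ≡⟨ set-cong s₀ x st≗st′ j ⟩
        set s₀ x st′ j     ≡⟨ cong (_$ j) (place-forced st′ i′ x s₀ frs₀′ filled′) ⟨
        place st′ i′ x j   ∎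
        where
          open ≡-Reasoning
          frs₀′ = trans (cong (λ m → A s₀ ∧ is-nothing m) (sym (st≗st′ s₀))) frs₀

module Queue {n : ℕ} {{_ : NonZero n}} (q : Subset n) where

  c : ℕ
  c = ∣ q ∣

  c≤n : c ≤ n
  c≤n = ∣p∣≤n q

  outside : Fin n → Bool
  outside j = not (inQ q j)

  module PI  = Scan.Placement leftward outside
  module PII = Scan.Placement rightward (inQ q)

  empty : State {n}
  empty _ = nothing

  placeI : (ℕ → Fin n) → (ℕ → ℕ) → State → ℕ → State
  placeI ρ v st a = PI.place st (ρ a) (v a)

  placeII : (ℕ → Fin n) → (ℕ → ℕ) → State → ℕ → State
  placeII ρ v st a = PII.place st (ρ a) (v a)

  phaseI : (ℕ → Fin n) → (ℕ → ℕ) → State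
  phaseI ρ vI = foldDown (placeI ρ vI) empty c (n ∸ c)

  phases : (ℕ → Fin n) → (ℕ → ℕ) → (ℕ → ℕ) → State
  phases ρ vI vII = foldUp (placeII ρ vII) (phaseI ρ vI) 0 c

  -- listing σ a is the site i_(a+1) of the sorted order; phase I handles the indices n - 1, ..., c
  -- (in that order) and phase II the indices 0, ..., c - 1.
  listing : Permutation′ n → ℕ → Fin n
  listing σ a = σ ⟨$⟩ʳ (a mod n)

  mod-toℕ : ∀ (i : Fin n) → toℕ i mod n ≡ i
  mod-toℕ i = toℕ-injective (trans (toℕ-mod (toℕ i)) (m<n⇒m%n≡m (toℕ<n i)))

  queue-phases : ∀ σ u → queue q σ u ≡
    tabulate (fromMaybe 0 ∘ phases (listing σ) (suc ∘ lookup u ∘ listing σ) (lookup u ∘ listing σ))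
  queue-phases σ u = cong (λ st → tabulate (fromMaybe 0 ∘ st)) (begin
    foldl stII (foldl stI empty (reverse (drop c (allFin n)))) (take c (allFin n))
      ≡⟨ cong₂ (λ l l′ → foldl stII (foldl stI empty (reverse (drop c l))) (take c l′)) allFin≡ allFin≡ ⟩
    foldl stII (foldl stI empty (reverse (drop c sites))) (take c sites)
      ≡⟨ cong₂ (λ l l′ → foldl stII (foldl stI empty (reverse l)) l′)
               (drop-applyUpTo (_mod n) c n) (take-applyUpTo (_mod n) c n c≤n) ⟩
    foldl stII (foldl stI empty (reverse (applyUpTo (λ a → (c + a) mod n) (n ∸ c)))) (applyUpTo (_mod n) c)
      ≡⟨ cong (λ st → foldl stII st (applyUpTo (_mod n) c))
              (Listₚ.reverse-foldl stI empty (applyUpTo (λ a → (c + a) mod n) (n ∸ c))) ⟩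
    foldl stII (foldr (λ a st → stI st a) empty (applyUpTo (λ a → (c + a) mod n) (n ∸ c))) (applyUpTo (_mod n) c)
      ≡⟨ cong (λ st → foldl stII st (applyUpTo (_mod n) c)) (foldr-applyUpTo stI (_mod n) empty c (n ∸ c) _ (λ _ → refl)) ⟩
    foldl stII (phaseI (listing σ) (suc ∘ lookup u ∘ listing σ)) (applyUpTo (_mod n) c)
      ≡⟨ foldl-applyUpTo stII (_mod n) _ 0 c _ (λ _ → refl) ⟩
    phases (listing σ) (suc ∘ lookup u ∘ listing σ) (lookup u ∘ listing σ) ∎)
    where
      open ≡-Reasoning
      stI : State → Fin n → State
      stI st a = stepI q u st (σ ⟨$⟩ʳ a)
      stII : State → Fin n → State
      stII st a = stepII q u st (σ ⟨$⟩ʳ a)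
      sites : List (Fin n)
      sites = applyUpTo (_mod n) n
      allFin≡ : allFin n ≡ sites
      allFin≡ = tabulate-applyUpTo (λ i → i) (_mod n) (sym ∘ mod-toℕ)

  c≡countᵇ : c ≡ countᵇ (inQ q)
  c≡countᵇ = trans (count≡countᵇ (Bool._≟ true) q) (countᵇ-cong (λ j → does≟true (lookup q j)))
    where
      does≟true : ∀ b → does (b Bool.≟ true) ≡ b
      does≟true true  = refl
      does≟true false = refl

  countᵇ-outside : countᵇ outside ≡ n ∸ c
  countᵇ-outside = trans (sym (m+n∸m≡n c (countᵇ outside))) (cong (_∸ c) sizes)
    where
      open ≡-Reasoning
      sizes : c + countᵇ outside ≡ n
      sizes = begin
        c + countᵇ outside                                               ≡⟨ cong (_+ countᵇ outside) c≡countᵇ ⟩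
        countᵇ (inQ q) + countᵇ outside                                  ≡⟨ cong₂ _+_ (countᵇ-cong {g = inQ q} (λ _ → ∧-identityʳ _))
                                                                                      (countᵇ-cong {g = outside} (λ _ → ∧-identityʳ _)) ⟨
        countᵇ (λ j → inQ q j ∧ true) + countᵇ (λ j → outside j ∧ true)  ≡⟨ countᵇ-split (inQ q) (λ _ → true) ⟨
        countᵇ (λ (_ : Fin n) → true)                                    ≡⟨ countᵇ-true _ (λ _ → refl) ⟩
        n                                                                ∎

  phaseI-invariant : ∀ ρ vI m len → c ≤ m → m + len ≡ n →
    (∀ j → inQ q j ≡ true → foldDown (placeI ρ vI) empty m len j ≡ nothing) ×
    (∀ P → countIn outside P (foldDown (placeI ρ vI) empty m len) ≡ countFrom (P ∘ vI) m len)
  phaseI-invariant ρ vI m zero      _   _   = (λ _ _ → refl) , (λ P → countᵇ-false _ (λ j → ∧-zeroʳ (outside j)))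
  phaseI-invariant ρ vI m (suc len) c≤m end = q-part , count-part
    where
      st = foldDown (placeI ρ vI) empty (suc m) len
      ih = phaseI-invariant ρ vI (suc m) len (m≤n⇒m≤1+n c≤m) (trans (sym (+-suc m len)) end)
      room : countIn outside always st < countᵇ outside
      room = begin-strict
        countIn outside always st   ≡⟨ trans (proj₂ ih always) (countFrom-true _ (suc m) len (λ _ _ _ → refl)) ⟩
        len                          <⟨ n<1+n len ⟩
        suc len                      ≡⟨ trans (cong (_∸ m) (sym end)) (m+n∸m≡n m (suc len)) ⟨
        n ∸ m                        ≤⟨ ∸-monoʳ-≤ n c≤m ⟩
        n ∸ c                        ≡⟨ countᵇ-outside ⟨
        countᵇ outside               ∎
        where open ≤-Reasoning
      step = PI.place-fills-hole st (ρ m) (vI m) room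
      q-part : ∀ j → inQ q j ≡ true → placeI ρ vI st m j ≡ nothing
      q-part j qj = trans (proj₁ step j (cong not qj)) (proj₁ ih j qj)
      count-part : ∀ P → countIn outside P (placeI ρ vI st m) ≡ countFrom (P ∘ vI) m (suc len)
      count-part P = trans (proj₂ step P) (cong (𝟙 (P (vI m)) +_) (proj₂ ih P))

  phaseII-invariant : ∀ ρ vII st a len → countIn (inQ q) always st + len ≤ c →
    (∀ j → inQ q j ≡ false → foldUp (placeII ρ vII) st a len j ≡ st j) ×
    (∀ P → countIn (inQ q) P (foldUp (placeII ρ vII) st a len) ≡ countIn (inQ q) P st + countFrom (P ∘ vII) a len)
  phaseII-invariant ρ vII st a zero      _    = (λ _ _ → refl) , (λ P → sym (+-identityʳ _))
  phaseII-invariant ρ vII st a (suc len) fits = kept , count-part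
    where
      room : countIn (inQ q) always st < countᵇ (inQ q)
      room = subst (countIn (inQ q) always st <_) c≡countᵇ (<-≤-trans (m<m+n _ (s≤s z≤n)) fits)
      step = PII.place-fills-hole st (ρ a) (vII a) room
      ih = phaseII-invariant ρ vII (placeII ρ vII st a) (suc a) len
             (subst (_≤ c) (trans (+-suc _ len) (cong (_+ len) (sym (proj₂ step always)))) fits)
      kept : ∀ j → inQ q j ≡ false → foldUp (placeII ρ vII) (placeII ρ vII st a) (suc a) len j ≡ st j
      kept j ¬qj = trans (proj₁ ih j ¬qj) (proj₁ step j ¬qj)
      count-part : ∀ P → countIn (inQ q) P (foldUp (placeII ρ vII) (placeII ρ vII st a) (suc a) len)
                         ≡ countIn (inQ q) P st + countFrom (P ∘ vII) a (suc len)
      count-part P = trans (proj₂ ih P) (trans (cong (_+ countFrom (P ∘ vII) (suc a) len) (proj₂ step P))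
                                               (trans (+-assoc (𝟙 (P (vII a))) _ _) (x∙yz≈y∙xz (𝟙 (P (vII a))) (countIn (inQ q) P st) _)))

  phaseI-leaves-q : ∀ ρ vI j → inQ q j ≡ true → phaseI ρ vI j ≡ nothing
  phaseI-leaves-q ρ vI = proj₁ (phaseI-invariant ρ vI c (n ∸ c) ≤-refl (m+[n∸m]≡n c≤n))

  phaseI-count : ∀ ρ vI P → countIn outside P (phaseI ρ vI) ≡ countFrom (P ∘ vI) c (n ∸ c)
  phaseI-count ρ vI = proj₂ (phaseI-invariant ρ vI c (n ∸ c) ≤-refl (m+[n∸m]≡n c≤n))

  countIn-unset : ∀ P (st : State) → (∀ j → inQ q j ≡ true → st j ≡ nothing) → countIn (inQ q) P st ≡ 0
  countIn-unset P st unset = countᵇ-false _ zero-at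
    where
      zero-at : ∀ j → (inQ q j ∧ satisfies P (st j)) ≡ false
      zero-at j with inQ q j in qj
      ... | true rewrite unset j qj = refl
      ... | false = refl

  phaseI-room : ∀ ρ vI → countIn (inQ q) always (phaseI ρ vI) + c ≤ c
  phaseI-room ρ vI = ≤-reflexive (cong (_+ c) (countIn-unset always _ (phaseI-leaves-q ρ vI)))

  phases-keep-outside : ∀ ρ vI vII j → inQ q j ≡ false → phases ρ vI vII j ≡ phaseI ρ vI j
  phases-keep-outside ρ vI vII = proj₁ (phaseII-invariant ρ vII (phaseI ρ vI) 0 c (phaseI-room ρ vI))

  phaseII-count : ∀ ρ vI vII P → countIn (inQ q) P (phases ρ vI vII) ≡ countFrom (P ∘ vII) 0 c
  phaseII-count ρ vI vII P = trans (proj₂ (phaseII-invariant ρ vII (phaseI ρ vI) 0 c (phaseI-room ρ vI)) P)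
                                   (cong (_+ countFrom (P ∘ vII) 0 c) (countIn-unset P _ (phaseI-leaves-q ρ vI)))

  phases-count : ∀ ρ vI vII P →
    countᵇ (λ j → satisfies P (phases ρ vI vII j)) ≡ countFrom (P ∘ vI) c (n ∸ c) + countFrom (P ∘ vII) 0 c
  phases-count ρ vI vII P = begin
    countᵇ (λ j → satisfies P (final j))                    ≡⟨ countᵇ-split (inQ q) (λ j → satisfies P (final j)) ⟩
    countIn (inQ q) P final + countIn outside P final       ≡⟨ cong₂ _+_ (phaseII-count ρ vI vII P) (countᵇ-cong outside-agree) ⟩
    countFrom (P ∘ vII) 0 c + countIn outside P (phaseI ρ vI) ≡⟨ cong (countFrom (P ∘ vII) 0 c +_) (phaseI-count ρ vI P) ⟩
    countFrom (P ∘ vII) 0 c + countFrom (P ∘ vI) c (n ∸ c) ≡⟨ +-comm (countFrom (P ∘ vII) 0 c) _ ⟩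
    countFrom (P ∘ vI) c (n ∸ c) + countFrom (P ∘ vII) 0 c ∎
    where
      open ≡-Reasoning
      final = phases ρ vI vII
      outside-agree : ∀ j → (outside j ∧ satisfies P (final j)) ≡ (outside j ∧ satisfies P (phaseI ρ vI j))
      outside-agree j with inQ q j in qj
      ... | true  = refl
      ... | false = cong (satisfies P) (phases-keep-outside ρ vI vII j qj)

  phases-filled : ∀ ρ vI vII j → satisfies always (phases ρ vI vII j) ≡ true
  phases-filled ρ vI vII = countᵇ≡size⇒true _ (begin
    countᵇ (λ j → satisfies always (phases ρ vI vII j))     ≡⟨ phases-count ρ vI vII always ⟩
    countFrom always c (n ∸ c) + countFrom always 0 c       ≡⟨ cong₂ _+_ (countFrom-true _ c _ (λ _ _ _ → refl))
                                                                         (countFrom-true _ 0 c (λ _ _ _ → refl)) ⟩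
    (n ∸ c) + c                                              ≡⟨ m∸n+n≡m c≤n ⟩
    n                                                        ∎)
    where open ≡-Reasoning

  phaseI-filled : ∀ ρ vI j → inQ q j ≡ false → satisfies always (phaseI ρ vI j) ≡ true
  phaseI-filled ρ vI j ¬qj = trans (cong (satisfies always) (sym (phases-keep-outside ρ vI vI j ¬qj))) (phases-filled ρ vI vI j)

  phases-map : ∀ ρ vI vI′ vII vII′ (h : ℕ → ℕ) →
    Within c (n ∸ c) (λ a → h (vI a) ≡ vI′ a) → Within 0 c (λ a → h (vII a) ≡ vII′ a) →
    phases ρ vI′ vII′ ≗ Maybe.map h ∘ phases ρ vI vII
  phases-map ρ vI vI′ vII vII′ h hI hII =
    foldUp-sim Relabels 0 c (λ a 0≤a a<c → PII.place-map h (ρ a) (hII a 0≤a a<c))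
      (foldDown-sim Relabels c (n ∸ c) (λ a c≤a a<n → PI.place-map h (ρ a) (hI a c≤a a<n)) (λ _ → refl))
    where
      Relabels : State → State → Set
      Relabels s t = t ≗ Maybe.map h ∘ s

module Order {n : ℕ} {{_ : NonZero n}} (q : Subset n) where
  open Queue q
  open AdjacentSwaps (Fin n →-setoid Maybe ℕ)

  module ForWord (w : Word n) where

    insertI : (ℕ → Fin n) → State → ℕ → State
    insertI ρ = placeI ρ (suc ∘ lookup w ∘ ρ)

    insertII : (ℕ → Fin n) → State → ℕ → State
    insertII ρ = placeII ρ (lookup w ∘ ρ)

    run : (ℕ → Fin n) → State
    run ρ = phases ρ (suc ∘ lookup w ∘ ρ) (lookup w ∘ ρ)

    insertI-cong : ∀ ρ ρ′ a a′ {s s′} → ρ a ≡ ρ′ a′ → s ≗ s′ → insertI ρ s a ≗ insertI ρ′ s′ a′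
    insertI-cong ρ ρ′ a a′ e s≗s′ rewrite e = PI.place-cong (ρ′ a′) _ s≗s′

    insertII-cong : ∀ ρ ρ′ a a′ {s s′} → ρ a ≡ ρ′ a′ → s ≗ s′ → insertII ρ s a ≗ insertII ρ′ s′ a′
    insertII-cong ρ ρ′ a a′ e s≗s′ rewrite e = PII.place-cong (ρ′ a′) _ s≗s′

    phaseI-agree : ∀ ρ ρ′ → Within c (n ∸ c) (λ a → ρ a ≡ ρ′ a) → phaseI ρ (suc ∘ lookup w ∘ ρ) ≗ phaseI ρ′ (suc ∘ lookup w ∘ ρ′)
    phaseI-agree ρ ρ′ agree = foldDown-sim _≗_ c (n ∸ c) (λ a c≤a a<n → insertI-cong ρ ρ′ a a (agree a c≤a a<n)) (λ _ → refl)

    run-agree : ∀ ρ ρ′ → (∀ a → a < n → ρ a ≡ ρ′ a) → run ρ ≗ run ρ′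
    run-agree ρ ρ′ agree = foldUp-sim _≗_ 0 c (λ a _ a<c → insertII-cong ρ ρ′ a a (agree a (<-≤-trans a<c c≤n)))
                             (phaseI-agree ρ ρ′ (λ a _ a<n → agree a (subst (a <_) (m+[n∸m]≡n c≤n) a<n)))

    phaseIʷ : (ℕ → Fin n) → State
    phaseIʷ ρ = phaseI ρ (suc ∘ lookup w ∘ ρ)

    module Swapped (ρ : ℕ → Fin n) (p : ℕ) (tie : lookup w (ρ p) ≡ lookup w (ρ (suc p))) where

      ρ′ : ℕ → Fin n
      ρ′ = ρ ∘ swap p

      swapI : AdjacentSwap (insertI ρ) (insertI ρ′) p
      swapI = record
        { congˡ     = λ a → insertI-cong ρ ρ a a refl
        ; congʳ     = λ a → insertI-cong ρ′ ρ′ a a refl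
        ; elsewhere = λ s a a≢p a≢p+1 → insertI-cong ρ′ ρ a a (cong ρ (swap-other p a a≢p a≢p+1)) (λ _ → refl)
        ; at-p      = λ s → insertI-cong ρ′ ρ p (suc p) (cong ρ (swap-at p)) (λ _ → refl)
        ; at-suc-p  = λ s → insertI-cong ρ′ ρ (suc p) p (cong ρ (swap-at-suc p)) (λ _ → refl)
        ; commute   = λ s → subst (λ x → PI.place (PI.place s (ρ p) (suc x)) (ρ (suc p)) (suc (lookup w (ρ (suc p))))
                                         ≗ PI.place (PI.place s (ρ (suc p)) (suc (lookup w (ρ (suc p))))) (ρ p) (suc x))
                                  (sym tie) (PI.place-comm s (ρ p) (ρ (suc p)) _)
        }

      swapII : AdjacentSwap (insertII ρ) (insertII ρ′) p
      swapII = record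
        { congˡ     = λ a → insertII-cong ρ ρ a a refl
        ; congʳ     = λ a → insertII-cong ρ′ ρ′ a a refl
        ; elsewhere = λ s a a≢p a≢p+1 → insertII-cong ρ′ ρ a a (cong ρ (swap-other p a a≢p a≢p+1)) (λ _ → refl)
        ; at-p      = λ s → insertII-cong ρ′ ρ p (suc p) (cong ρ (swap-at p)) (λ _ → refl)
        ; at-suc-p  = λ s → insertII-cong ρ′ ρ (suc p) p (cong ρ (swap-at-suc p)) (λ _ → refl)
        ; commute   = λ s → subst (λ x → PII.place (PII.place s (ρ p) x) (ρ (suc p)) (lookup w (ρ (suc p)))
                                         ≗ PII.place (PII.place s (ρ (suc p)) (lookup w (ρ (suc p)))) (ρ p) x)
                                  (sym tie) (PII.place-comm s (ρ p) (ρ (suc p)) _)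
        }

      above-swap : ∀ a → suc p < a → ρ′ a ≡ ρ a
      above-swap a p+1<a = cong ρ (swap-other p a (λ a≡p → <⇒≱ p+1<a (≤-trans (≤-reflexive a≡p) (n≤1+n p)))
                                                   (λ a≡p+1 → <⇒≱ p+1<a (≤-reflexive a≡p+1)))

      below-swap : ∀ a → a < p → ρ′ a ≡ ρ a
      below-swap a a<p = cong ρ (swap-other p a (<⇒≢ a<p) (<⇒≢ (<-trans a<p (n<1+n p))))

      -- When the swap straddles the phases, each affected placement is the last of its phase and fills
      -- the single remaining hole, whatever its starting site.
      phaseI-boundary : suc p ≡ c → c < n → phaseIʷ ρ′ ≗ phaseIʷ ρ
      phaseI-boundary p+1≡c c<n j = begin
        phaseIʷ ρ′ j                       ≡⟨ cong (_$ j) (last ρ′) ⟩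
        insertI ρ′ (before ρ′) c j         ≡⟨ PI.place-forced-agree (ρ′ c) (ρ c) s₀ before≗ same-value free′ (filled ρ′) (filled ρ) j ⟩
        insertI ρ (before ρ) c j           ≡⟨ cong (_$ j) (last ρ) ⟨
        phaseIʷ ρ j                        ∎
        where
          open ≡-Reasoning
          len = n ∸ suc c
          before : (ℕ → Fin n) → State
          before ρ₀ = foldDown (insertI ρ₀) empty (suc c) len
          last : ∀ ρ₀ → phaseIʷ ρ₀ ≡ insertI ρ₀ (before ρ₀) c
          last ρ₀ = cong (foldDown (insertI ρ₀) empty c) (+-∸-assoc 1 c<n)
          before≗ : before ρ′ ≗ before ρ
          before≗ = foldDown-sim _≗_ (suc c) len
                      (λ a c<a _ → insertI-cong ρ′ ρ a a (above-swap a (subst (_< a) (sym p+1≡c) c<a))) (λ _ → refl)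
          room : countIn outside always (before ρ) < countᵇ outside
          room = subst₂ _<_ (sym (trans (proj₂ (phaseI-invariant ρ _ (suc c) len (n≤1+n c) (m+[n∸m]≡n c<n)) always)
                                        (countFrom-true always (suc c) len (λ _ _ _ → refl))))
                            (sym (trans countᵇ-outside (+-∸-assoc 1 c<n))) (n<1+n len)
          hole = hole-exists outside (before ρ) room
          s₀ = proj₁ hole
          free′ : PI.free (before ρ′) s₀ ≡ true
          free′ = PI.hole⇒free s₀ before≗ (proj₂ hole)
          filled : ∀ ρ₀ → satisfies always (insertI ρ₀ (before ρ₀) c s₀) ≡ true
          filled ρ₀ = subst (λ st → satisfies always (st s₀) ≡ true) (last ρ₀)
                        (phaseI-filled ρ₀ _ s₀ (trans (sym (not-involutive _)) (cong not (proj₁ (proj₂ hole)))))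
          same-value : suc (lookup w (ρ′ c)) ≡ suc (lookup w (ρ c))
          same-value = cong suc (begin
            lookup w (ρ (swap p c))       ≡⟨ cong (lookup w ∘ ρ ∘ swap p) p+1≡c ⟨
            lookup w (ρ (swap p (suc p))) ≡⟨ cong (lookup w ∘ ρ) (swap-at-suc p) ⟩
            lookup w (ρ p)                ≡⟨ tie ⟩
            lookup w (ρ (suc p))          ≡⟨ cong (lookup w ∘ ρ) p+1≡c ⟩
            lookup w (ρ c)                ∎)

      run-boundary : suc p ≡ c → c < n → run ρ′ ≗ run ρ
      run-boundary p+1≡c c<n j = begin
        run ρ′ j                       ≡⟨ cong (_$ j) (last ρ′) ⟩
        insertII ρ′ (before ρ′) p j    ≡⟨ PII.place-forced-agree (ρ′ p) (ρ p) s₀ before≗ same-value free′ (filled ρ′) (filled ρ) j ⟩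
        insertII ρ (before ρ) p j      ≡⟨ cong (_$ j) (last ρ) ⟨
        run ρ j                        ∎
        where
          open ≡-Reasoning
          before : (ℕ → Fin n) → State
          before ρ₀ = foldUp (insertII ρ₀) (phaseIʷ ρ₀) 0 p
          last : ∀ ρ₀ → run ρ₀ ≡ insertII ρ₀ (before ρ₀) p
          last ρ₀ = trans (cong (foldUp (insertII ρ₀) (phaseIʷ ρ₀) 0) (sym p+1≡c)) (foldUp-last _ _ 0 p)
          before≗ : before ρ′ ≗ before ρ
          before≗ = foldUp-sim _≗_ 0 p (λ a _ a<p → insertII-cong ρ′ ρ a a (below-swap a a<p)) (phaseI-boundary p+1≡c c<n)
          empty-q : countIn (inQ q) always (phaseIʷ ρ) ≡ 0
          empty-q = countIn-unset always _ (phaseI-leaves-q ρ _)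
          room : countIn (inQ q) always (before ρ) < countᵇ (inQ q)
          room = subst₂ _<_
            (sym (trans (proj₂ (phaseII-invariant ρ _ (phaseIʷ ρ) 0 p
                                  (subst (_≤ c) (cong (_+ p) (sym empty-q)) (≤-trans (n≤1+n p) (≤-reflexive p+1≡c)))) always)
                        (cong₂ _+_ empty-q (countFrom-true always 0 p (λ _ _ _ → refl)))))
            (trans p+1≡c c≡countᵇ) (n<1+n p)
          hole = hole-exists (inQ q) (before ρ) room
          s₀ = proj₁ hole
          free′ : PII.free (before ρ′) s₀ ≡ true
          free′ = PII.hole⇒free s₀ before≗ (proj₂ hole)
          filled : ∀ ρ₀ → satisfies always (insertII ρ₀ (before ρ₀) p s₀) ≡ true
          filled ρ₀ = subst (λ st → satisfies always (st s₀) ≡ true) (last ρ₀) (phases-filled ρ₀ _ _ s₀)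
          same-value : lookup w (ρ′ p) ≡ lookup w (ρ p)
          same-value = trans (cong (lookup w ∘ ρ) (swap-at p)) (sym tie)

      run-swap : suc p < n → run ρ′ ≗ run ρ
      run-swap p+1<n with <-cmp (suc p) c
      ... | tri≈ _ p+1≡c _ = run-boundary p+1≡c (subst (_< n) p+1≡c p+1<n)
      ... | tri< p+1<c _ _ = λ j → trans (foldUp-swap swapII (phaseIʷ ρ′) 0 c z≤n p+1<c j)
          (foldUp-sim _≗_ 0 c (λ a _ _ → insertII-cong ρ ρ a a refl)
                           (phaseI-agree ρ′ ρ (λ a c≤a _ → above-swap a (<-≤-trans p+1<c c≤a))) j)
      ... | tri> _ _ c<p+1 = foldUp-sim _≗_ 0 c (λ a _ a<c → insertII-cong ρ′ ρ a a (below-swap a (<-≤-trans a<c c≤p)))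
          (foldDown-swap swapI empty c (n ∸ c) c≤p (subst (suc p <_) (sym (m+[n∸m]≡n c≤n)) p+1<n))
        where c≤p = ≤-pred c<p+1

    record SortedListing (ρ : ℕ → Fin n) : Set where
      field
        sorted     : ∀ a b → a ≤ b → b < n → lookup w (ρ a) ≤ lookup w (ρ b)
        injective  : ∀ a b → a < n → b < n → ρ a ≡ ρ b → a ≡ b
        surjective : ∀ s → ∃[ a ] (a < n × ρ a ≡ s)
    open SortedListing

    swap-values : ∀ (ρ : ℕ → Fin n) p → lookup w (ρ p) ≡ lookup w (ρ (suc p)) → ∀ a → lookup w (ρ (swap p a)) ≡ lookup w (ρ a)
    swap-values ρ p tie a with a ≟ p
    ... | yes refl = sym tie
    ... | no  _ with a ≟ suc p
    ...   | yes refl = tie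
    ...   | no  _    = refl

    swap-sorted : ∀ ρ p → SortedListing ρ → suc p < n → lookup w (ρ p) ≡ lookup w (ρ (suc p)) → SortedListing (ρ ∘ swap p)
    swap-sorted ρ p S p+1<n tie = record
      { sorted     = λ a b a≤b b<n → subst₂ _≤_ (sym (swap-values ρ p tie a)) (sym (swap-values ρ p tie b)) (sorted S a b a≤b b<n)
      ; injective  = λ a b a<n b<n e → begin
          a                   ≡⟨ swap-involutive p a ⟨
          swap p (swap p a)   ≡⟨ cong (swap p) (injective S _ _ (swap-< p a p+1<n a<n) (swap-< p b p+1<n b<n) e) ⟩
          swap p (swap p b)   ≡⟨ swap-involutive p b ⟩
          b                   ∎
      ; surjective = λ s → let (a , a<n , ρa≡s) = surjective S s in
                           swap p a , swap-< p a p+1<n a<n , trans (cong ρ (swap-involutive p a)) ρa≡s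
      }
      where open ≡-Reasoning

    record Bubbled (τ : ℕ → Fin n) (m t : ℕ) : Set where
      field
        reordered : ℕ → Fin n
        isSorted  : SortedListing reordered
        brings    : reordered m ≡ τ t
        keeps     : ∀ a → a < m → reordered a ≡ τ a
        same-run  : run reordered ≗ run τ

    bubble : ∀ d τ m → SortedListing τ → m + d < n → lookup w (τ m) ≡ lookup w (τ (m + d)) → Bubbled τ m (m + d)
    bubble zero    τ m S _ _ = record
      { reordered = τ ; isSorted = S ; brings = cong τ (sym (+-identityʳ m)) ; keeps = λ _ _ → refl ; same-run = λ _ → refl }
    bubble (suc d) τ m S end<n tie = record
      { reordered = reordered B
      ; isSorted = isSorted B
      ; brings   = trans (brings B) (trans (cong τ (swap-at t)) (cong τ (sym (+-suc m d))))
      ; keeps    = λ a a<m → trans (keeps B a a<m)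
                     (cong τ (swap-other t a (<⇒≢ (<-≤-trans a<m (m≤m+n m d))) (<⇒≢ (<-≤-trans a<m (≤-trans (m≤m+n m d) (n≤1+n t))))))
      ; same-run = λ j → trans (same-run B j) (Swapped.run-swap τ t tie′ t+1<n j)
      }
      where
        open Bubbled
        t = m + d
        t+1<n : suc t < n
        t+1<n = subst (_< n) (+-suc m d) end<n
        moved≡first : lookup w (τ (suc t)) ≡ lookup w (τ m)
        moved≡first = trans (cong (lookup w ∘ τ) (sym (+-suc m d))) (sym tie)
        tie′ : lookup w (τ t) ≡ lookup w (τ (suc t))
        tie′ = ≤-antisym (sorted S t (suc t) (n≤1+n t) t+1<n)
                 (subst (_≤ lookup w (τ t)) (sym moved≡first) (sorted S m t (m≤m+n m d) (<-trans (n<1+n t) t+1<n)))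
        τ′ = τ ∘ swap t
        tie″ : lookup w (τ′ m) ≡ lookup w (τ′ t)
        tie″ = trans (swap-values τ t tie′ m) (trans (sym moved≡first) (sym (cong (lookup w ∘ τ) (swap-at t))))
        B = bubble d τ′ m (swap-sorted τ t S t+1<n tie′) (<-trans (n<1+n t) t+1<n) tie″

    sorted-run-agree : ∀ k m ρ τ → m + k ≡ n → SortedListing ρ → SortedListing τ →
                       (∀ a → a < m → ρ a ≡ τ a) → run ρ ≗ run τ
    sorted-run-agree zero    m ρ τ end Sρ Sτ agree =
      run-agree ρ τ (λ a a<n → agree a (subst (a <_) (trans (sym end) (+-identityʳ m)) a<n))
    sorted-run-agree (suc k) m ρ τ end Sρ Sτ agree j =
      trans (sorted-run-agree k (suc m) ρ (reordered B) (trans (sym (+-suc m k)) end) Sρ (isSorted B) agree′ j) (same-run B j)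
      where
        open Bubbled
        m<n : m < n
        m<n = subst (m <_) end (m<m+n m (s≤s z≤n))
        m≤ : ∀ {σ₁ σ₂ : ℕ → Fin n} → SortedListing σ₁ → (∀ a → a < m → σ₂ a ≡ σ₁ a) → ∀ x → x < n → σ₂ x ≡ σ₁ m → m ≤ x
        m≤ S₁ agree₂₁ x x<n e with x <? m
        ... | no  x≮m = ≮⇒≥ x≮m
        ... | yes x<m = ⊥-elim (<⇒≢ x<m (injective S₁ x m (<-trans x<m m<n) m<n (trans (sym (agree₂₁ x x<m)) e)))
        b = proj₁ (surjective Sτ (ρ m))
        b<n = proj₁ (proj₂ (surjective Sτ (ρ m)))
        τb≡ρm = proj₂ (proj₂ (surjective Sτ (ρ m)))
        m′ = proj₁ (surjective Sρ (τ m))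
        m′<n = proj₁ (proj₂ (surjective Sρ (τ m)))
        ρm′≡τm = proj₂ (proj₂ (surjective Sρ (τ m)))
        m≤b = m≤ Sρ (λ a a<m → sym (agree a a<m)) b b<n τb≡ρm
        m≤m′ = m≤ Sτ agree m′ m′<n ρm′≡τm
        tie : lookup w (τ m) ≡ lookup w (τ b)
        tie = ≤-antisym (sorted Sτ m b m≤b b<n)
                (subst₂ _≤_ (cong (lookup w) (sym τb≡ρm)) (cong (lookup w) ρm′≡τm)
                  (sorted Sρ m m′ m≤m′ m′<n))
        b≡m+d = sym (m+[n∸m]≡n m≤b)
        B = bubble (b ∸ m) τ m Sτ (subst (_< n) b≡m+d b<n) (trans tie (cong (lookup w ∘ τ) b≡m+d))
        agree′ : ∀ a → a < suc m → ρ a ≡ reordered B a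
        agree′ a a<m+1 with a ≟ m
        ... | yes refl = sym (trans (brings B) (trans (cong τ (sym b≡m+d)) τb≡ρm))
        ... | no  a≢m  = trans (agree a a<m) (sym (keeps B a a<m))
          where a<m = ≤∧≢⇒< (≤-pred a<m+1) a≢m

  open ForWord public using (run)

  listing-sorted : ∀ w σ → SortsBy σ w → ForWord.SortedListing w (listing σ)
  listing-sorted w σ σ-sorts = record
    { sorted     = λ a b a≤b b<n → σ-sorts (a mod n) (b mod n)
                                     (subst₂ _≤_ (sym (toℕ-mod< a (≤-<-trans a≤b b<n))) (sym (toℕ-mod< b b<n)) a≤b)
    ; injective  = λ a b a<n b<n e → begin
        a                      ≡⟨ toℕ-mod< a a<n ⟨
        toℕ (a mod n)          ≡⟨ cong toℕ (trans (sym (inverseˡ σ)) (trans (cong (σ ⟨$⟩ˡ_) e) (inverseˡ σ))) ⟩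
        toℕ (b mod n)          ≡⟨ toℕ-mod< b b<n ⟩
        b                      ∎
    ; surjective = λ s → toℕ (σ ⟨$⟩ˡ s) , toℕ<n _ , trans (cong (σ ⟨$⟩ʳ_) (mod-toℕ _)) (inverseʳ σ)
    }
    where
      open ≡-Reasoning
      toℕ-mod< : ∀ a → a < n → toℕ (a mod n) ≡ a
      toℕ-mod< a a<n = trans (toℕ-mod a) (m<n⇒m%n≡m a<n)

  run-independent : ∀ w σ τ → SortsBy σ w → SortsBy τ w → run w (listing σ) ≗ run w (listing τ)
  run-independent w σ τ σ-sorts τ-sorts =
    ForWord.sorted-run-agree w n 0 (listing σ) (listing τ) refl (listing-sorted w σ σ-sorts) (listing-sorted w τ τ-sorts) (λ _ ())


  queue-sort-independent : ∀ w σ τ → SortsBy σ w → SortsBy τ w → queue q σ w ≡ queue q τ w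
  queue-sort-independent w σ τ σ-sorts τ-sorts = begin
    queue q σ w                                  ≡⟨ queue-phases σ w ⟩
    tabulate (fromMaybe 0 ∘ run w (listing σ))   ≡⟨ tabulate-cong (cong (fromMaybe 0) ∘ run-independent w σ τ σ-sorts τ-sorts) ⟩
    tabulate (fromMaybe 0 ∘ run w (listing τ))   ≡⟨ queue-phases τ w ⟨
    queue q τ w                                  ∎
    where open ≡-Reasoning

<⇒≤∸1 : ∀ {m n} → m < n → m ≤ n ∸ 1
<⇒≤∸1 (s≤s m≤n) = m≤n

flatten : ℕ → ℕ → ℕ
flatten j x = if does (x ≤? j) then x else x ∸ 1

flatten-≤ : ∀ {j x} → x ≤ j → flatten j x ≡ x
flatten-≤ {j} {x} x≤j = cong (λ b → if b then x else x ∸ 1) (dec-true (x ≤? j) x≤j)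

flatten-> : ∀ {j x} → j < x → flatten j x ≡ x ∸ 1
flatten-> {j} {x} j<x = cong (λ b → if b then x else x ∸ 1) (dec-false (x ≤? j) (<⇒≱ j<x))

flatten-mono : ∀ j {x y} → x ≤ y → flatten j x ≤ flatten j y
flatten-mono j {x} {y} x≤y with x ≤? j | y ≤? j
... | yes x≤j | yes y≤j = subst₂ _≤_ (sym (flatten-≤ x≤j)) (sym (flatten-≤ y≤j)) x≤y
... | yes x≤j | no  y≰j = subst₂ _≤_ (sym (flatten-≤ x≤j)) (sym (flatten-> (≰⇒> y≰j))) (≤-trans x≤j (<⇒≤∸1 (≰⇒> y≰j)))
... | no  x≰j | yes y≤j = ⊥-elim (x≰j (≤-trans x≤y y≤j))
... | no  x≰j | no  y≰j = subst₂ _≤_ (sym (flatten-> (≰⇒> x≰j))) (sym (flatten-> (≰⇒> y≰j))) (∸-monoˡ-≤ 1 x≤y)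

flatten-suc-above : ∀ {j x} → j < x → flatten j (suc x) ≡ suc (flatten j x)
flatten-suc-above {j} {suc x} j<x = trans (flatten-> (<-trans j<x (n<1+n _))) (cong suc (sym (flatten-> j<x)))


flatten-suc-suc : ∀ j x → flatten (suc j) (suc x) ≡ suc (flatten j x)
flatten-suc-suc j x with x ≤? j
... | yes x≤j = trans (flatten-≤ (s≤s x≤j)) (cong suc (sym (flatten-≤ x≤j)))
... | no  x≰j = trans (flatten-> (s≤s j<x)) (trans (sym (flatten-> (<-trans j<x (n<1+n x)))) (flatten-suc-above j<x))
  where j<x = ≰⇒> x≰j

flatten-suc-below : ∀ {j x} → x ≤ j → flatten (suc j) x ≡ flatten j x
flatten-suc-below x≤j = trans (flatten-≤ (m≤n⇒m≤1+n x≤j)) (sym (flatten-≤ x≤j))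

from1to : ℕ → ℕ → Bool
from1to j v = does (1 ≤? v) ∧ does (v ≤? j)

module Letters {m : ℕ} (w : Word m) where

  atMost : ℕ → Fin m → Bool
  atMost j = from1to j ∘ lookup w

  letter-split : ∀ j v → 𝟙 (from1to (suc j) v) ≡ 𝟙 (from1to j v) + 𝟙 (does (v ≟ suc j))
  letter-split j v with <-cmp v (suc j)
  ... | tri< v<j+1 v≢j+1 _
    rewrite dec-true (v ≤? suc j) (<⇒≤ v<j+1) | dec-true (v ≤? j) (≤-pred v<j+1) | dec-false (v ≟ suc j) v≢j+1 = sym (+-identityʳ _)
  ... | tri≈ _ refl _
    rewrite dec-true (suc j ≤? suc j) ≤-refl | dec-false (suc j ≤? j) 1+n≰n | dec-true (suc j ≟ suc j) refl = refl
  ... | tri> _ v≢j+1 j+1<v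
    rewrite dec-false (v ≤? suc j) (<⇒≱ j+1<v) | dec-false (v ≤? j) (<⇒≱ (<-trans (n<1+n j) j+1<v))
          | dec-false (v ≟ suc j) v≢j+1 | ∧-zeroʳ (does (1 ≤? v)) = refl

  p≡countᵇ : ∀ j → p j w ≡ countᵇ (atMost j)
  p≡countᵇ zero    = sym (countᵇ-false (atMost zero) (λ i → empty-range (lookup w i)))
    where
      empty-range : ∀ v → from1to 0 v ≡ false
      empty-range zero    = refl
      empty-range (suc v) = refl
  p≡countᵇ (suc j) = begin
    p j w + mult (suc j) w                                             ≡⟨ cong₂ _+_ (p≡countᵇ j) (count≡countᵇ (_≟ suc j) w) ⟩
    countᵇ (atMost j) + countᵇ (λ i → does (lookup w i ≟ suc j))       ≡⟨ countᵇ-+ _ _ _ (letter-split j ∘ lookup w) ⟨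
    countᵇ (atMost (suc j))                                            ∎
    where open ≡-Reasoning

  p-mono : ∀ {a b} → a ≤ b → p a w ≤ p b w
  p-mono {b = zero}  z≤n = ≤-refl
  p-mono {a} {suc b} a≤b+1 with m≤n⇒m<n∨m≡n a≤b+1
  ... | inj₁ a<b+1 = ≤-trans (p-mono (≤-pred a<b+1)) (m≤m+n _ _)
  ... | inj₂ refl  = ≤-refl

  count<≡p : IsWord w → ∀ x → count (_<? suc x) w ≡ p x w
  count<≡p isWord x = trans (count≡countᵇ (_<? suc x) w) (trans (countᵇ-cong below) (sym (p≡countᵇ x)))
    where
      below : ∀ i → does (lookup w i <? suc x) ≡ atMost x i
      below i rewrite dec-true (1 ≤? lookup w i) (isWord i) = does-⇔ (mk⇔ ≤-pred s≤s) (lookup w i <? suc x) (lookup w i ≤? x)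

  vee≡flatten : IsWord w → ∀ j k → k ≡ p j w → vee k w ≡ tabulate (flatten j ∘ lookup w)
  vee≡flatten isWord j k k≡pj = tabulate-cong λ i → cong (λ b → if b then lookup w i else lookup w i ∸ 1) (kept⇔small i)
    where
      kept⇔small : ∀ i → does (count (_<? lookup w i) w <? k) ≡ does (lookup w i ≤? j)
      kept⇔small i with lookup w i in wi | isWord i
      ... | suc x | _ rewrite count<≡p isWord x | k≡pj = does-⇔ (mk⇔ fewer⇒small small⇒fewer) (p x w <? p j w) (suc x ≤? j)
        where
          fewer⇒small : p x w < p j w → suc x ≤ j
          fewer⇒small px<pj = ≰⇒> (λ j≤x → <⇒≱ px<pj (p-mono j≤x))
          occurs : 1 ≤ mult (suc x) w
          occurs = subst (1 ≤_) (sym (count≡countᵇ (_≟ suc x) w)) (countᵇ-positive _ i (dec-true (lookup w i ≟ suc x) wi))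
          small⇒fewer : suc x ≤ j → p x w < p j w
          small⇒fewer x<j = <-≤-trans (subst (_≤ p x w + mult (suc x) w) (+-comm (p x w) 1) (+-monoʳ-≤ (p x w) occurs)) (p-mono x<j)

  lookup-vee : IsWord w → ∀ j k → k ≡ p j w → ∀ i → lookup (vee k w) i ≡ flatten j (lookup w i)
  lookup-vee isWord j k k≡pj i = trans (cong (λ v → lookup v i) (vee≡flatten isWord j k k≡pj)) (lookup∘tabulate _ i)

vee-sorts : ∀ {n} {{_ : NonZero n}} {u : Word n} {σ} j k → IsWord u → k ≡ p j u → SortsBy σ u → SortsBy σ (vee k u)
vee-sorts {u = u} {σ} j k isWord k≡pj σ-sorts a b a≤b =
  subst₂ _≤_ (sym (lookup-vee _)) (sym (lookup-vee _)) (flatten-mono j (σ-sorts a b a≤b))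
  where lookup-vee = Letters.lookup-vee u isWord j k k≡pj

module Flattening {n : ℕ} {{_ : NonZero n}} (u : Word n) (isWord : IsWord u) (k j : ℕ) (k≡pj : k ≡ p j u)
                  (q : Subset n) (σ : Permutation′ n) (σ-sorts : SortsBy σ u) where
  open Queue q
  open Letters u

  ρ : ℕ → Fin n
  ρ = listing σ

  small : Fin n → Bool
  small i = does (lookup u (σ ⟨$⟩ʳ i) ≤? j)

  count-small : countᵇ small ≡ k
  count-small = begin
    countᵇ small                                    ≡⟨ countᵇ-permute (λ s → does (lookup u s ≤? j)) σ ⟨
    countᵇ (λ s → does (lookup u s ≤? j))           ≡⟨ countᵇ-cong (λ s → cong (_∧ does (lookup u s ≤? j))
                                                                                 (dec-true (1 ≤? lookup u s) (isWord s))) ⟨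
    countᵇ (atMost j)                               ≡⟨ trans k≡pj (p≡countᵇ j) ⟨
    k                                               ∎
    where open ≡-Reasoning

  small⇔early : ∀ a → a < n → does (lookup u (ρ a) ≤? j) ≡ does (a <? k)
  small⇔early a a<n = trans (countᵇ-downClosed small closed (a mod n))
                            (cong₂ (λ x y → does (x <? y)) (trans (toℕ-mod a) (m<n⇒m%n≡m a<n)) count-small)
    where
      closed : ∀ x y → toℕ x ≤ toℕ y → small y ≡ true → small x ≡ true
      closed x y x≤y small-y = dec-true (_ ≤? j) (≤-trans (σ-sorts x y x≤y) (does⇒ (_ ≤? j) small-y))

  k≤n : k ≤ n
  k≤n = subst (_≤ n) count-small (countᵇ-≤ small)

  index< : ∀ {a} → a < c + (n ∸ c) → a < n
  index< {a} = subst (a <_) (m+[n∸m]≡n c≤n)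

  from1to-letter : ∀ j′ a → from1to j′ (lookup u (ρ a)) ≡ does (lookup u (ρ a) ≤? j′)
  from1to-letter j′ a = cong (_∧ does (lookup u (ρ a) ≤? j′)) (dec-true (1 ≤? lookup u (ρ a)) (isWord (ρ a)))

  record Rethreshold : Set where
    field
      j′              : ℕ
      1≤j′            : 1 ≤ j′
      flatten-phaseI  : Within c (n ∸ c) (λ a → flatten j′ (suc (lookup u (ρ a))) ≡ suc (flatten j (lookup u (ρ a))))
      flatten-phaseII : Within 0 c (λ a → flatten j′ (lookup u (ρ a)) ≡ flatten j (lookup u (ρ a)))
      counts-k        : countFrom (from1to j′ ∘ suc ∘ lookup u ∘ ρ) c (n ∸ c) + countFrom (from1to j′ ∘ lookup u ∘ ρ) 0 c ≡ k

  threshold-kept : 1 ≤ j → k ≤ c → Rethreshold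
  threshold-kept 1≤j k≤c = record
    { j′ = j ; 1≤j′ = 1≤j
    ; flatten-phaseI  = λ a c≤a a<end → flatten-suc-above (large a c≤a a<end)
    ; flatten-phaseII = λ _ _ _ → refl
    ; counts-k = cong₂ _+_
        (countFrom-false _ c (n ∸ c) λ a c≤a a<end → dec-false (suc (lookup u (ρ a)) ≤? j) (<⇒≱ (m<n⇒m<1+n (large a c≤a a<end))))
        (countFrom-threshold _ 0 c k z≤n k≤c λ a _ a<c → trans (from1to-letter j a) (small⇔early a (<-≤-trans a<c c≤n)))
    }
    where
      large : ∀ a → c ≤ a → a < c + (n ∸ c) → j < lookup u (ρ a)
      large a c≤a a<end = ≰⇒> (does⇒¬ (_ ≤? j) (trans (small⇔early a (index< a<end))
                                                  (dec-false (a <? k) (λ a<k → <⇒≱ (<-≤-trans a<k k≤c) c≤a))))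

  threshold-raised : c < k → Rethreshold
  threshold-raised c<k = record
    { j′ = suc j ; 1≤j′ = s≤s z≤n
    ; flatten-phaseI  = λ a _ _ → flatten-suc-suc j (lookup u (ρ a))
    ; flatten-phaseII = λ a _ a<c → flatten-suc-below (early-small a a<c)
    ; counts-k = trans (cong₂ _+_
        (countFrom-threshold _ c (n ∸ c) k (<⇒≤ c<k) (subst (k ≤_) (sym (m+[n∸m]≡n c≤n)) k≤n)
           λ a c≤a a<end → trans (does-⇔ (mk⇔ ≤-pred s≤s) (suc (lookup u (ρ a)) ≤? suc j) (lookup u (ρ a) ≤? j))
                                 (small⇔early a (index< a<end)))
        (countFrom-true _ 0 c λ a _ a<c → trans (from1to-letter (suc j) a) (dec-true (_ ≤? suc j) (m≤n⇒m≤1+n (early-small a a<c)))))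
        (m∸n+n≡m (<⇒≤ c<k))
    }
    where
      early-small : ∀ a → a < c → lookup u (ρ a) ≤ j
      early-small a a<c = does⇒ (_ ≤? j) (trans (small⇔early a (<-≤-trans a<c c≤n)) (dec-true (a <? k) (<-trans a<c c<k)))

  rethreshold : 1 ≤ j → Rethreshold
  rethreshold 1≤j with k ≤? c
  ... | yes k≤c = threshold-kept 1≤j k≤c
  ... | no  k≰c = threshold-raised (≰⇒> k≰c)

  module Outcome (T : Rethreshold) where
    open Rethreshold T

    Q : Word n
    Q = queue q σ u

    R : State
    R = phases ρ (suc ∘ lookup u ∘ ρ) (lookup u ∘ ρ)

    lookup-Q : ∀ s → lookup Q s ≡ fromMaybe 0 (R s)
    lookup-Q s = trans (cong (λ v → lookup v s) (queue-phases σ u)) (lookup∘tabulate _ s)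

    Q-isWord : IsWord Q
    Q-isWord s = subst (1 ≤_) (sym (lookup-Q s)) (positive (R s) (countᵇ≡size⇒true _ all-positive s))
      where
        positive : ∀ m → satisfies (λ v → does (1 ≤? v)) m ≡ true → 1 ≤ fromMaybe 0 m
        positive (just v) holds = does⇒ (1 ≤? v) holds
        all-positive : countᵇ (λ s → satisfies (λ v → does (1 ≤? v)) (R s)) ≡ n
        all-positive = begin
          countᵇ (λ s → satisfies (λ v → does (1 ≤? v)) (R s))  ≡⟨ phases-count ρ _ _ _ ⟩
          countFrom _ c (n ∸ c) + countFrom _ 0 c                 ≡⟨ cong₂ _+_ (countFrom-true _ c _ (λ _ _ _ → refl))
                                                                         (countFrom-true _ 0 c (λ a _ _ → dec-true (1 ≤? _) (isWord (ρ a)))) ⟩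
          (n ∸ c) + c                                            ≡⟨ m∸n+n≡m c≤n ⟩
          n                                                      ∎
          where open ≡-Reasoning

    k≡pQ : k ≡ p j′ Q
    k≡pQ = sym (begin
      p j′ Q                                        ≡⟨ Letters.p≡countᵇ Q j′ ⟩
      countᵇ (from1to j′ ∘ lookup Q)                ≡⟨ countᵇ-cong (λ s → trans (cong (from1to j′) (lookup-Q s))
                                                                                (from1to-fromMaybe (R s))) ⟩
      countᵇ (satisfies (from1to j′) ∘ R)           ≡⟨ phases-count ρ _ _ _ ⟩
      _                                             ≡⟨ counts-k ⟩
      k                                             ∎)
      where
        open ≡-Reasoning
        from1to-fromMaybe : ∀ m → from1to j′ (fromMaybe 0 m) ≡ satisfies (from1to j′) m
        from1to-fromMaybe nothing  = refl
        from1to-fromMaybe (just _) = refl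

    vee-queue : vee k Q ≡ queue q σ (vee k u)
    vee-queue = begin
      vee k Q                                                 ≡⟨ Letters.vee≡flatten Q Q-isWord j′ k k≡pQ ⟩
      tabulate (flatten j′ ∘ lookup Q)                        ≡⟨ tabulate-cong (λ s → cong (flatten j′) (lookup-Q s)) ⟩
      tabulate (flatten j′ ∘ fromMaybe 0 ∘ R)                 ≡⟨ tabulate-cong (λ s → flatten-fromMaybe (R s)) ⟨
      tabulate (fromMaybe 0 ∘ Maybe.map (flatten j′) ∘ R)          ≡⟨ tabulate-cong (λ s → cong (fromMaybe 0) (relabel s)) ⟨
      tabulate (fromMaybe 0 ∘ phases ρ (suc ∘ lookup u′ ∘ ρ) (lookup u′ ∘ ρ)) ≡⟨ queue-phases σ u′ ⟨
      queue q σ u′                                            ∎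
      where
        open ≡-Reasoning
        u′ = vee k u
        lookup-u′ = Letters.lookup-vee u isWord j k k≡pj
        flatten-fromMaybe : ∀ m → fromMaybe 0 (Maybe.map (flatten j′) m) ≡ flatten j′ (fromMaybe 0 m)
        flatten-fromMaybe nothing  = refl
        flatten-fromMaybe (just _) = refl
        relabel : phases ρ (suc ∘ lookup u′ ∘ ρ) (lookup u′ ∘ ρ) ≗ Maybe.map (flatten j′) ∘ R
        relabel = phases-map ρ _ _ _ _ (flatten j′)
          (λ a c≤a a<end → trans (flatten-phaseI a c≤a a<end) (cong suc (sym (lookup-u′ (ρ a)))))
          (λ a 0≤a a<c → trans (flatten-phaseII a 0≤a a<c) (sym (lookup-u′ (ρ a))))

lemma3p2 : (n : ℕ) {{_ : NonZero n}} (u : Word n) → IsWord u →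
           (k : ℕ) → VeeWellDefined k u → (q : Subset n) →
           (σ : Permutation′ n) → SortsBy σ u →
           (τ : Permutation′ n) → SortsBy τ (vee k u) →
           VeeWellDefined k (queue q σ u) × VeeWellDefined k u
             × vee k (queue q σ u) ≡ queue q τ (vee k u)
lemma3p2 n u isWord k (j , 1≤j , k≡pj) q σ σ-sorts τ τ-sorts =
  (j′ , 1≤j′ , k≡pQ) , (j , 1≤j , k≡pj) , (begin
    vee k (queue q σ u)   ≡⟨ vee-queue ⟩
    queue q σ (vee k u)   ≡⟨ Order.queue-sort-independent q (vee k u) σ τ (vee-sorts {σ = σ} j k isWord k≡pj σ-sorts) τ-sorts ⟩
    queue q τ (vee k u)   ∎)
  where
    open ≡-Reasoning
    open Flattening u isWord k j k≡pj q σ σ-sorts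
    open Rethreshold (rethreshold 1≤j)
    open Outcome (rethreshold 1≤j)
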